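{- Let $P$ be a finite poset, $\ell,q$ positive integers, $u,v$ as in the context, and assume $R^q$ is defined. For every $f\in\mathcal L_{P\times[\ell]}(u,v,R^q)$: (1) $\mathrm{Evac}^2(f)=f$; (2) $\mathrm{Evac}\circ\mathrm{Pro}(f)=\mathrm{Pro}^{ -1}\circ\mathrm{Evac}(f)$.
   Context: $P\times[\ell]=\{(p,i):p\in P,1\le i\le\ell\}$; $u,v:P\to\{0,\ldots,\ell\}$ satisfy $u(p)+v(p)\le\ell$ and $v(p_1)\le v(p_2)$, $u(p_1)\ge u(p_2)$ when $p_1\le_Pp_2$; $P\times[\ell]^v_u=\{(p,i):u(p)<i<\ell+1-v(p)\}$, fibers $F_p=\{(p,i)\in P\times[\ell]^v_u\}$. For a map $R$ from $P$ to nonempty finite subsets of $\mathbb Z$, $\mathcal L_{P\times[\ell]}(u,v,R)$ is the set of $f:P\times[\ell]^v_u\to\mathbb Z$ with $f(p_1,i)<f(p_2,i)$ for $p_1<_Pp_2$, $f(p,i_1)\le f(p,i_2)$ for $i_1\le i_2$, $f(p,i)\in R(p)$. $R^q(p)$: the set of $k\in\{1,\ldots,q\}$ attained as $f(p,i)$ by some $f\in\mathcal L_{P\times[\ell]}(u,v,p\mapsto\{1,\ldots,q\})$ (assumed nonempty). With $R=R^q$: $R(p)_{>k}$ is the smallest element of $R(p)$ above $k$; $f(p,i)$ is raisable (lowerable) if some $g\in\mathcal L_{P\times[\ell]}(u,v,R)$ has $g(p,i)>f(p,i)$ (resp. $<$) and $g(p',i')=f(p',i')$ whenever $p'\ne p$.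 Bender–Knuth $\rho_k$: in each fiber $F_p$ with $k\in R(p)$, $k\ne\max R(p)$ (others unchanged), free labels are raisable labels equal to $k$ and lowerable labels equal to $R(p)_{>k}$; if they read $a$ copies of $k$ then $b$ copies of $R(p)_{>k}$, replace them by $b$ copies of $k$ then $a$ copies of $R(p)_{>k}$. $\mathrm{Pro}=\cdots\circ\rho_2\circ\rho_1\circ\rho_0\circ\rho_{ -1}\circ\cdots$. $\mathrm{Evac}=(\rho_1)\circ(\rho_2\circ\rho_1)\circ\cdots\circ(\rho_{q-2}\circ\cdots\circ\rho_1)\circ(\rho_{q-1}\circ\cdots\circ\rho_2\circ\rho_1)$. -}

module Defs where

open import Data.Nat using (ℕ; zero; suc; _+_; _∸_; _≤_; _<_; _⊔_; z≤n; s≤s)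
import Data.Nat as ℕ
import Data.Nat.Properties as ℕP
open import Data.Fin using (Fin; toℕ) renaming (zero to fz; suc to fs)
import Data.Fin as F
import Data.Fin.Properties as FP
open import Data.Vec using (Vec; []; _∷_; lookup; tabulate)
open import Data.Vec.Relation.Unary.All using (All; []; _∷_)
open import Data.List using (List; filter; allFin; upTo; length; head; foldr)
open import Data.Maybe using (maybe)
open import Data.Product using (Σ; ∃; _×_; _,_; proj₁; proj₂)
open import Data.Sum using (_⊎_; inj₁; inj₂)
open import Data.Unit using (⊤; tt)
open import Data.Bool using (Bool; if_then_else_)
open import Relation.Nullary using (Dec; yes; no; ¬_; does; ¬?)
open import Relation.Nullary.Decidable using (_×-dec_; _⊎-dec_; _→-dec_)
open import Relation.Unary using (Decidable)
open import Relation.Binary.PropositionalEquality using (_≡_; _≢_; refl)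
open import Relation.Binary.Structures using (IsDecPartialOrder)

-- Labelings: one vector (the fiber F_p, read in increasing i) per p.

DVec : (n : ℕ) → (Fin n → ℕ) → Set
DVec zero    L = ⊤
DVec (suc n) L = Vec ℕ (L fz) × DVec n (λ p → L (fs p))

fiber : ∀ {n} {L : Fin n → ℕ} → DVec n L → (p : Fin n) → Vec ℕ (L p)
fiber {suc n} (w , _) fz     = w
fiber {suc n} (_ , d) (fs p) = fiber d p

tabulateD : ∀ {n} (L : Fin n → ℕ) → ((p : Fin n) → Vec ℕ (L p)) → DVec n L
tabulateD {zero}  L g = tt
tabulateD {suc n} L g = g fz , tabulateD (λ p → L (fs p)) (λ p → g (fs p))

-- all entries ≤ q (only used to make finite searches decidable;
-- it is implied by the value constraints wherever it is used)
BoundedD : ℕ → ∀ {n} {L : Fin n → ℕ} → DVec n L → Set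
BoundedD q {zero}  d       = ⊤
BoundedD q {suc n} (w , d) = All (_≤ q) w × BoundedD q d

dec∃≤ : ∀ q {P : ℕ → Set} → Decidable P → Dec (∃ λ x → x ≤ q × P x)
dec∃≤ zero {P} P? with P? 0
... | yes p = yes (0 , z≤n , p)
... | no ¬p = no λ { (zero , _ , p) → ¬p p }
dec∃≤ (suc q) {P} P? with P? (suc q) | dec∃≤ q P?
... | yes p | _ = yes (suc q , ℕP.≤-refl , p)
... | no _  | yes (x , x≤ , p) = yes (x , ℕP.m≤n⇒m≤1+n x≤ , p)
... | no ¬p | no ¬r = no λ { (x , x≤ , p) → h x x≤ p }
  where
  h : ∀ x → x ≤ suc q → P x → _
  h x x≤ p with ℕP.m≤n⇒m<n∨m≡n x≤
  ... | inj₁ (s≤s x≤q) = ¬r (x , x≤q , p)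
  ... | inj₂ refl      = ¬p p

dec∃Vec : ∀ q m {P : Vec ℕ m → Set} → Decidable P → Dec (∃ λ w → All (_≤ q) w × P w)
dec∃Vec q zero {P} P? with P? []
... | yes p = yes ([] , [] , p)
... | no ¬p = no λ { ([] , _ , p) → ¬p p }
dec∃Vec q (suc m) {P} P? with dec∃Vec q m {λ w → ∃ λ x → x ≤ q × P (x ∷ w)} (λ w → dec∃≤ q (λ x → P? (x ∷ w)))
... | yes (w , bw , x , x≤ , p) = yes (x ∷ w , x≤ ∷ bw , p)
... | no ¬r = no λ { (x ∷ w , x≤ ∷ bw , p) → ¬r (w , bw , x , x≤ , p) }

dec∃D : ∀ q n (L : Fin n → ℕ) {P : DVec n L → Set} → Decidable P → Dec (∃ λ d → BoundedD q d × P d)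
dec∃D q zero L {P} P? with P? tt
... | yes p = yes (tt , tt , p)
... | no ¬p = no λ { (tt , _ , p) → ¬p p }
dec∃D q (suc n) L {P} P?
  with dec∃Vec q (L fz) {λ w → ∃ λ d → BoundedD q d × P (w , d)}
         (λ w → dec∃D q n (λ p → L (fs p)) (λ d → P? (w , d)))
... | yes (w , bw , d , bd , p) = yes ((w , d) , (bw , bd) , p)
... | no ¬r = no λ { ((w , d) , (bw , bd) , p) → ¬r (w , bw , d , bd , p) }

-- The setting: finite poset P = (Fin n, ≼), ℓ, q, u, v.
-- Fiber F_p = {(p,i) : u p < i < ℓ + 1 - v p}; position j : Fin (len p)
-- of the fiber vector corresponds to i = u p + 1 + toℕ j.

module Setup {n : ℕ} {_≼_ : Fin n → Fin n → Set}
             (po : IsDecPartialOrder _≡_ _≼_)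
             (ℓ q : ℕ) (u v : Fin n → ℕ) where

  open IsDecPartialOrder po using () renaming (_≤?_ to _≼?_)

  _≺_ : Fin n → Fin n → Set
  p ≺ p' = p ≼ p' × p ≢ p'

  _≺?_ : ∀ p p' → Dec (p ≺ p')
  p ≺? p' = (p ≼? p') ×-dec ¬? (p FP.≟ p')

  len : Fin n → ℕ
  len p = ℓ ∸ (u p + v p)

  Lab : Set
  Lab = DVec n len

  val : Lab → (p : Fin n) → Fin (len p) → ℕ
  val f p j = lookup (fiber f p) j

  StrictCond : Lab → Set
  StrictCond f = ∀ p₁ p₂ → p₁ ≺ p₂ → ∀ (j₁ : Fin (len p₁)) (j₂ : Fin (len p₂)) →
                 u p₁ + toℕ j₁ ≡ u p₂ + toℕ j₂ → val f p₁ j₁ < val f p₂ j₂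

  WeakCond : Lab → Set
  WeakCond f = ∀ p (j₁ j₂ : Fin (len p)) → j₁ F.≤ j₂ → val f p j₁ ≤ val f p j₂

  RangeCond : (Fin n → ℕ → Set) → Lab → Set
  RangeCond R f = ∀ p j → R p (val f p j)

  InL : (Fin n → ℕ → Set) → Lab → Set
  InL R f = StrictCond f × WeakCond f × RangeCond R f

  InL? : (R : Fin n → ℕ → Set) → (∀ p k → Dec (R p k)) → ∀ f → Dec (InL R f)
  InL? R R? f =
    FP.all? (λ p₁ → FP.all? λ p₂ → (p₁ ≺? p₂) →-dec FP.all? λ j₁ → FP.all? λ j₂ →
      (u p₁ + toℕ j₁ ℕ.≟ u p₂ + toℕ j₂) →-dec (val f p₁ j₁ ℕ.<? val f p₂ j₂))
    ×-dec FP.all? (λ p → FP.all? λ j₁ → FP.all? λ j₂ → (j₁ F.≤? j₂) →-dec (val f p j₁ ℕ.≤? val f p j₂))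
    ×-dec FP.all? (λ p → FP.all? λ j → R? p (val f p j))

  Iq : Fin n → ℕ → Set
  Iq _ k = 1 ≤ k × k ≤ q

  Iq? : ∀ p k → Dec (Iq p k)
  Iq? _ k = (1 ℕ.≤? k) ×-dec (k ℕ.≤? q)

  Rq : Fin n → ℕ → Set
  Rq p k = ∃ λ f → BoundedD q f × InL Iq f × ∃ λ j → val f p j ≡ k

  Rq? : ∀ p k → Dec (Rq p k)
  Rq? p k = dec∃D q n len (λ f → InL? Iq Iq? f ×-dec FP.any? (λ j → val f p j ℕ.≟ k))

  -- R^q(p) as a sorted list (R^q(p) ⊆ {1..q})
  Rlist : Fin n → List ℕ
  Rlist p = filter (Rq? p) (upTo (suc q))

  maxR : Fin n → ℕ
  maxR p = foldr _⊔_ 0 (Rlist p)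

  nextR : Fin n → ℕ → ℕ
  nextR p k = maybe (λ x → x) 0 (head (filter (k ℕ.<?_) (Rlist p)))

  update : Lab → (p : Fin n) → Vec ℕ (len p) → Lab
  update f p w = tabulateD len upd
    where
    upd : (p' : Fin n) → Vec ℕ (len p')
    upd p' with p' FP.≟ p
    ... | yes refl = w
    ... | no _     = fiber f p'

  Raisable : Lab → (p : Fin n) → Fin (len p) → Set
  Raisable f p j = ∃ λ w → All (_≤ q) w × InL Rq (update f p w) × val f p j < lookup w j

  Lowerable : Lab → (p : Fin n) → Fin (len p) → Set
  Lowerable f p j = ∃ λ w → All (_≤ q) w × InL Rq (update f p w) × lookup w j < val f p j

  Raisable? : ∀ f p j → Dec (Raisable f p j)
  Raisable? f p j = dec∃Vec q (len p) (λ w → InL? Rq Rq? (update f p w) ×-dec (val f p j ℕ.<? lookup w j))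

  Lowerable? : ∀ f p j → Dec (Lowerable f p j)
  Lowerable? f p j = dec∃Vec q (len p) (λ w → InL? Rq Rq? (update f p w) ×-dec (lookup w j ℕ.<? val f p j))

  Free : ℕ → Lab → (p : Fin n) → Fin (len p) → Set
  Free k f p j = (val f p j ≡ k × Raisable f p j) ⊎ (val f p j ≡ nextR p k × Lowerable f p j)

  Free? : ∀ k f p j → Dec (Free k f p j)
  Free? k f p j = ((val f p j ℕ.≟ k) ×-dec Raisable? f p j)
                  ⊎-dec ((val f p j ℕ.≟ nextR p k) ×-dec Lowerable? f p j)

  countB : ℕ → Lab → (p : Fin n) → ℕ
  countB k f p = length (filter (λ j → Free? k f p j ×-dec (val f p j ℕ.≟ nextR p k)) (allFin (len p)))

  freeBefore : ℕ → Lab → (p : Fin n) → Fin (len p) → ℕ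
  freeBefore k f p j = length (filter (λ j' → Free? k f p j' ×-dec (j' F.<? j)) (allFin (len p)))

  -- the free labels (a copies of k, then b copies of k') become
  -- b copies of k, then a copies of k'
  newFiber : ℕ → Lab → (p : Fin n) → Vec ℕ (len p)
  newFiber k f p = tabulate λ j →
    if does (Free? k f p j)
    then (if does (freeBefore k f p j ℕ.<? countB k f p) then k else nextR p k)
    else val f p j

  Active? : (p : Fin n) → (k : ℕ) → Dec (Rq p k × k ≢ maxR p)
  Active? p k = Rq? p k ×-dec ¬? (k ℕ.≟ maxR p)

  ρ : ℕ → Lab → Lab
  ρ k f = tabulateD len λ p → if does (Active? p k) then newFiber k f p else fiber f p

  chain : ℕ → Lab → Lab
  chain zero    f = f
  chain (suc m) f = ρ (suc m) (chain m f)

  -- Pro = ⋯ ∘ ρ_1 ∘ ρ_0 ∘ ρ_{-1} ∘ ⋯ ; only ρ_1,…,ρ_{q-1} can act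
  -- nontrivially since R^q(p) ⊆ {1,…,q}
  Pro : Lab → Lab
  Pro = chain (q ∸ 1)

  evacAux : ℕ → Lab → Lab
  evacAux zero    f = f
  evacAux (suc m) f = evacAux m (chain (suc m) f)

  Evac : Lab → Lab
  Evac = evacAux (q ∸ 1)

{-# OPTIONS --safe #-}

-- Everything follows from three properties of the Bender–Knuth moves on L = L(u,v,R^q): each ρ_k
-- maps L to itself, is an involution of L, and commutes with ρ_j when |j − k| ≥ 2.  For such
-- involutions Evac² = id and Pro ∘ Evac ∘ Pro = Evac are formal (Berenstein–Kirillov).
--
-- The three properties rest on R^q(p) being an interval: the pointwise maximum of a labeling f and
-- g − c for another labeling g is again a labeling.  Hence if ρ_k moves a label of F_p then
-- R(p)_{>k} = k+1, and raisability and lowerability become local conditions on the labels of the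
-- neighbouring fibers.  These show that ρ_k does not change which positions are free, that the
-- free labels of a fiber read k…k followed by (k+1)…(k+1), so that ρ_k just exchanges the two
-- multiplicities, and that labels moved by ρ_k and by ρ_j with |j − k| ≥ 2 never interact.

module Submission where

open import Defs
open import Data.Bool using (if_then_else_)
open import Data.Empty using (⊥-elim)
open import Data.Fin using (Fin; toℕ) renaming (zero to fz; suc to fs)
import Data.Fin as F
import Data.Fin.Properties as FP
open import Data.List using (List; []; _∷_; filter; allFin; length; tabulate; foldr; head)
open import Data.List.Membership.Propositional using (_∈_)
open import Data.List.Membership.Propositional.Properties
  using (∈-filter⁺; ∈-filter⁻; ∈-upTo⁺; foldr-selective)
open import Data.List.Properties using (foldr-preservesᵒ)
import Data.List.Relation.Unary.All as LAll
open import Data.List.Relation.Unary.AllPairs using (AllPairs; _∷_)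
import Data.List.Relation.Unary.AllPairs.Properties as APP
open import Data.List.Relation.Unary.Any using (here; there)
import Data.List.Relation.Unary.Any as Any
open import Data.List.Relation.Unary.Any.Properties using (¬Any[])
open import Data.Maybe using (maybe)
open import Data.Nat using (ℕ; zero; suc; _+_; _∸_; _≤_; _<_; _⊓_; _⊔_; z≤n; s≤s)
import Data.Nat as ℕ
import Data.Nat.Properties as ℕP
open import Data.Product using (∃; _×_; _,_; proj₁; proj₂)
open import Data.Sum using (_⊎_; inj₁; inj₂; [_,_]′)
open import Data.Unit using (tt)
open import Data.Vec using (Vec; lookup)
import Data.Vec as Vec
import Data.Vec.Properties as VecP
open import Data.Vec.Relation.Binary.Pointwise.Extensional using (ext; Pointwise-≡⇒≡)
open import Data.Vec.Relation.Unary.All using (All)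
import Data.Vec.Relation.Unary.All.Properties as AllP
open import Function using (_∘_; flip)
open import Level using (0ℓ)
open import Relation.Binary.PropositionalEquality
  using (_≡_; _≢_; refl; sym; trans; cong; cong₂; subst; subst₂; module ≡-Reasoning)
open import Relation.Binary.Structures using (IsDecPartialOrder)
open import Relation.Nullary using (Dec; yes; no; ¬_; does)
open import Relation.Nullary.Decidable using (_×-dec_; dec-true; dec-false)
open import Relation.Unary using (Pred; Decidable; _⊆_; _∩_; ∁)
open import Relation.Unary.Properties using (_∩?_; ∁?)

module FinCount where

  tail? : ∀ {m} {P : Pred (Fin (suc m)) 0ℓ} → Decidable P → Decidable (λ i → P (fs i))
  tail? P? i = P? (fs i)

  count : ∀ {m} {P : Pred (Fin m) 0ℓ} → Decidable P → ℕ
  count {zero}  P? = 0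
  count {suc m} P? with P? fz
  ... | yes _ = suc (count (tail? P?))
  ... | no _  = count (tail? P?)

  length-filter-tabulate : ∀ {a} {A : Set a} {m} {P : Pred A 0ℓ} (P? : Decidable P) (g : Fin m → A) →
                           length (filter P? (tabulate g)) ≡ count (λ i → P? (g i))
  length-filter-tabulate {m = zero}  P? g = refl
  length-filter-tabulate {m = suc m} P? g with P? (g fz)
  ... | yes _ = cong suc (length-filter-tabulate P? (λ i → g (fs i)))
  ... | no _  = length-filter-tabulate P? (λ i → g (fs i))

  length-filter-allFin : ∀ {m} {P : Pred (Fin m) 0ℓ} (P? : Decidable P) →
                         length (filter P? (allFin m)) ≡ count P?
  length-filter-allFin P? = length-filter-tabulate P? (λ i → i)

  count-mono : ∀ {m} {P Q : Pred (Fin m) 0ℓ} (P? : Decidable P) (Q? : Decidable Q) →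
               P ⊆ Q → count P? ≤ count Q?
  count-mono {zero}  P? Q? P⊆Q = z≤n
  count-mono {suc m} P? Q? P⊆Q with P? fz | Q? fz
  ... | yes _ | yes _ = s≤s (count-mono (tail? P?) (tail? Q?) P⊆Q)
  ... | yes p | no ¬q = ⊥-elim (¬q (P⊆Q p))
  ... | no _  | yes _ = ℕP.m≤n⇒m≤1+n (count-mono (tail? P?) (tail? Q?) P⊆Q)
  ... | no _  | no _  = count-mono (tail? P?) (tail? Q?) P⊆Q

  count-cong : ∀ {m} {P Q : Pred (Fin m) 0ℓ} (P? : Decidable P) (Q? : Decidable Q) →
               P ⊆ Q → Q ⊆ P → count P? ≡ count Q?
  count-cong P? Q? P⊆Q Q⊆P = ℕP.≤-antisym (count-mono P? Q? P⊆Q) (count-mono Q? P? Q⊆P)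

  count-pos : ∀ {m} {P : Pred (Fin m) 0ℓ} (P? : Decidable P) {i} → P i → 0 < count P?
  count-pos {suc m} P? {i} p with P? fz | i
  ... | yes _ | _    = s≤s z≤n
  ... | no ¬p | fz   = ⊥-elim (¬p p)
  ... | no _  | fs i = count-pos (tail? P?) p

  count-split : ∀ {m} {P Q : Pred (Fin m) 0ℓ} (P? : Decidable P) (Q? : Decidable Q) →
                count P? ≡ count (P? ∩? Q?) + count (P? ∩? ∁? Q?)
  count-split {zero}  P? Q? = refl
  count-split {suc m} P? Q? with P? fz | Q? fz
  ... | yes _ | yes _ = cong suc (count-split (tail? P?) (tail? Q?))
  ... | yes _ | no _  = trans (cong suc (count-split (tail? P?) (tail? Q?))) (sym (ℕP.+-suc _ _))
  ... | no _  | _     = count-split (tail? P?) (tail? Q?)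

  count-empty : ∀ {m} {P : Pred (Fin m) 0ℓ} (P? : Decidable P) → (∀ i → ¬ P i) → count P? ≡ 0
  count-empty {zero}  P? ¬P = refl
  count-empty {suc m} P? ¬P with P? fz
  ... | yes p = ⊥-elim (¬P fz p)
  ... | no _  = count-empty (tail? P?) (λ i → ¬P (fs i))

  count-head-yes : ∀ {m} {P : Pred (Fin (suc m)) 0ℓ} (P? : Decidable P) → P fz → count P? ≡ suc (count (tail? P?))
  count-head-yes P? p with P? fz
  ... | yes _ = refl
  ... | no ¬p = ⊥-elim (¬p p)

  count-head-no : ∀ {m} {P : Pred (Fin (suc m)) 0ℓ} (P? : Decidable P) → ¬ P fz → count P? ≡ count (tail? P?)
  count-head-no P? ¬p with P? fz
  ... | yes p = ⊥-elim (¬p p)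
  ... | no _  = refl

  rank : ∀ {m} {P : Pred (Fin m) 0ℓ} → Decidable P → Fin m → ℕ
  rank P? j = count (P? ∩? (F._<? j))

  rank-mono : ∀ {m} {P : Pred (Fin m) 0ℓ} (P? : Decidable P) {i j} → i F.≤ j → rank P? i ≤ rank P? j
  rank-mono P? i≤j = count-mono (P? ∩? (F._<? _)) (P? ∩? (F._<? _)) λ (p , k<i) → p , ℕP.<-≤-trans k<i i≤j

  rank-cong : ∀ {m} {P Q : Pred (Fin m) 0ℓ} (P? : Decidable P) (Q? : Decidable Q) →
              P ⊆ Q → Q ⊆ P → ∀ j → rank P? j ≡ rank Q? j
  rank-cong P? Q? P⊆Q Q⊆P j = count-cong (P? ∩? (F._<? j)) (Q? ∩? (F._<? j))
    (λ (p , i<j) → P⊆Q p , i<j) (λ (q , i<j) → Q⊆P q , i<j)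

  rank-fz : ∀ {m} {P : Pred (Fin (suc m)) 0ℓ} (P? : Decidable P) → rank P? fz ≡ 0
  rank-fz {m} P? = count-empty (P? ∩? (F._<? fz {m})) λ _ → λ { (_ , ()) }

  private
    count-tail-<fs : ∀ {m} {P : Pred (Fin (suc m)) 0ℓ} (P? : Decidable P) i →
                     count (tail? (P? ∩? (F._<? fs i))) ≡ rank (tail? P?) i
    count-tail-<fs P? i = count-cong (tail? (P? ∩? (F._<? fs i))) (tail? P? ∩? (F._<? i))
      (λ { (p , s≤s k<i) → p , k<i }) (λ (p , k<i) → p , s≤s k<i)

  rank-fs-yes : ∀ {m} {P : Pred (Fin (suc m)) 0ℓ} (P? : Decidable P) → P fz → ∀ i →
                rank P? (fs i) ≡ suc (rank (tail? P?) i)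
  rank-fs-yes P? p i = trans (count-head-yes (P? ∩? (F._<? fs i)) (p , s≤s z≤n)) (cong suc (count-tail-<fs P? i))

  rank-fs-no : ∀ {m} {P : Pred (Fin (suc m)) 0ℓ} (P? : Decidable P) → ¬ P fz → ∀ i →
               rank P? (fs i) ≡ rank (tail? P?) i
  rank-fs-no P? ¬p i = trans (count-head-no (P? ∩? (F._<? fs i)) (¬p ∘ proj₁)) (count-tail-<fs P? i)

  count-rank< : ∀ {m} {P : Pred (Fin m) 0ℓ} (P? : Decidable P) b →
                count (P? ∩? λ i → rank P? i ℕ.<? b) ≡ b ⊓ count P?
  count-rank< {zero}  P? b       = sym (ℕP.⊓-zeroʳ b)
  count-rank< {suc m} P? zero    = count-empty (P? ∩? λ i → rank P? i ℕ.<? 0) λ _ → λ { (_ , ()) }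
  count-rank< {suc m} {P} P? (suc b) = by-head (P? fz)
    where
    open ≡-Reasoning
    below? : ∀ b′ → Decidable (λ i → rank P? i < b′)
    below? b′ i = rank P? i ℕ.<? b′
    below′? : ∀ b′ → Decidable (λ i → rank (tail? P?) i < b′)
    below′? b′ i = rank (tail? P?) i ℕ.<? b′

    by-head : Dec (P fz) → count (P? ∩? below? (suc b)) ≡ suc b ⊓ count P?
    by-head (yes p) = begin
      count (P? ∩? below? (suc b))
        ≡⟨ count-head-yes (P? ∩? below? (suc b)) (p , subst (_< suc b) (sym (rank-fz P?)) (s≤s z≤n)) ⟩
      suc (count (tail? (P? ∩? below? (suc b))))
        ≡⟨ cong suc (count-cong (tail? (P? ∩? below? (suc b))) (tail? P? ∩? below′? b)
             (λ (q , r<) → q , ℕP.≤-pred (subst (_< suc b) (rank-fs-yes P? p _) r<))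
             (λ (q , r<) → q , subst (_< suc b) (sym (rank-fs-yes P? p _)) (s≤s r<))) ⟩
      suc (count (tail? P? ∩? below′? b))
        ≡⟨ cong suc (count-rank< (tail? P?) b) ⟩
      suc b ⊓ suc (count (tail? P?))
        ≡⟨ cong (suc b ⊓_) (sym (count-head-yes P? p)) ⟩
      suc b ⊓ count P? ∎
    by-head (no ¬p) = begin
      count (P? ∩? below? (suc b))
        ≡⟨ count-head-no (P? ∩? below? (suc b)) (¬p ∘ proj₁) ⟩
      count (tail? (P? ∩? below? (suc b)))
        ≡⟨ count-cong (tail? (P? ∩? below? (suc b))) (tail? P? ∩? below′? (suc b))
             (λ (q , r<) → q , subst (_< suc b) (rank-fs-no P? ¬p _) r<)
             (λ (q , r<) → q , subst (_< suc b) (sym (rank-fs-no P? ¬p _)) r<) ⟩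
      count (tail? P? ∩? below′? (suc b))
        ≡⟨ count-rank< (tail? P?) (suc b) ⟩
      suc b ⊓ count (tail? P?)
        ≡⟨ cong (suc b ⊓_) (sym (count-head-no P? ¬p)) ⟩
      suc b ⊓ count P? ∎

  count-∖ : ∀ {m} {P Q : Pred (Fin m) 0ℓ} (P? : Decidable P) (Q? : Decidable Q) →
            count (P? ∩? ∁? Q?) ≡ count P? ∸ count (P? ∩? Q?)
  count-∖ P? Q? = trans (sym (ℕP.m+n∸m≡n (count (P? ∩? Q?)) _))
                        (cong (_∸ count (P? ∩? Q?)) (sym (count-split P? Q?)))

  count-rank≥ : ∀ {m} {P : Pred (Fin m) 0ℓ} (P? : Decidable P) {b} → b ≤ count P? →
                count (P? ∩? ∁? λ i → rank P? i ℕ.<? b) ≡ count P? ∸ b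
  count-rank≥ P? {b} b≤count = trans (count-∖ P? (λ i → rank P? i ℕ.<? b))
    (cong (count P? ∸_) (trans (count-rank< P? b) (ℕP.m≤n⇒m⊓n≡m b≤count)))

  rank<count : ∀ {m} {P Q : Pred (Fin m) 0ℓ} (P? : Decidable P) (Q? : Decidable Q) {j} →
               P ∩ (F._< j) ⊆ Q → Q j → rank P? j < count Q?
  rank<count P? Q? {j} below⊆Q qj = begin-strict
    rank P? j
      ≤⟨ count-mono (P? ∩? (F._<? j)) (Q? ∩? (F._<? j)) (λ (p , i<j) → below⊆Q (p , i<j) , i<j) ⟩
    count (Q? ∩? (F._<? j))
      <⟨ ℕP.m<m+n _ (count-pos (Q? ∩? ∁? (F._<? j)) (qj , ℕP.<-irrefl refl)) ⟩
    count (Q? ∩? (F._<? j)) + count (Q? ∩? ∁? (F._<? j))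
      ≡⟨ count-split Q? (F._<? j) ⟨
    count Q? ∎
    where open ℕP.≤-Reasoning

  count≤rank+count : ∀ {m} {P Q : Pred (Fin m) 0ℓ} (P? : Decidable P) (Q? : Decidable Q) {j} →
                     P ∩ ∁ (F._< j) ⊆ Q → count P? ≤ rank P? j + count Q?
  count≤rank+count P? Q? {j} above⊆Q = begin
    count P?
      ≡⟨ count-split P? (F._<? j) ⟩
    rank P? j + count (P? ∩? ∁? (F._<? j))
      ≤⟨ ℕP.+-monoʳ-≤ (rank P? j) (count-mono (P? ∩? ∁? (F._<? j)) Q? above⊆Q) ⟩
    rank P? j + count Q? ∎
    where open ℕP.≤-Reasoning

  UpwardClosedIn : ∀ {m} → Pred (Fin m) 0ℓ → Pred (Fin m) 0ℓ → Set
  UpwardClosedIn P B = ∀ {i i′} → P i → P i′ → i F.≤ i′ → B i → B i′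

  module _ {m} {P B : Pred (Fin m) 0ℓ} (P? : Decidable P) (B? : Decidable B) (B-upward : UpwardClosedIn P B) where

    ∉upset⇒rank< : ∀ {j} → P j → ¬ B j → rank P? j < count P? ∸ count (P? ∩? B?)
    ∉upset⇒rank< {j} pj ¬bj = subst (rank P? j <_) (count-∖ P? B?)
      (rank<count P? (P? ∩? ∁? B?) (λ (pi , i<j) → pi , λ bi → ¬bj (B-upward pi pj (ℕP.<⇒≤ i<j) bi)) (pj , ¬bj))

    ∈upset⇒rank≥ : ∀ {j} → P j → B j → count P? ∸ count (P? ∩? B?) ≤ rank P? j
    ∈upset⇒rank≥ {j} pj bj = ℕP.m≤n+o⇒m∸n≤o (count P?) (count (P? ∩? B?))
      (subst (count P? ≤_) (ℕP.+-comm (rank P? j) _)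
        (count≤rank+count P? (P? ∩? B?) λ (pi , i≮j) → pi , B-upward pj pi (ℕP.≮⇒≥ i≮j) bj))

open FinCount

module InvolutionWords {A : Set} (Ok : A → Set) (t : ℕ → A → A)
  (t-ok : ∀ k {x} → Ok x → Ok (t k x))
  (t-involutive : ∀ k {x} → Ok x → t k (t k x) ≡ x)
  (t-comm : ∀ i k → suc i < k → ∀ {x} → Ok x → t i (t k x) ≡ t k (t i x)) where

  open ≡-Reasoning

  chain chain⁻¹ evac : ℕ → A → A
  chain zero    x = x
  chain (suc m) x = t (suc m) (chain m x)

  chain⁻¹ zero    x = x
  chain⁻¹ (suc m) x = chain⁻¹ m (t (suc m) x)

  evac zero    x = x
  evac (suc m) x = evac m (chain (suc m) x)

  chain-ok : ∀ m {x} → Ok x → Ok (chain m x)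
  chain-ok zero    ok = ok
  chain-ok (suc m) ok = t-ok (suc m) (chain-ok m ok)

  chain⁻¹-ok : ∀ m {x} → Ok x → Ok (chain⁻¹ m x)
  chain⁻¹-ok zero    ok = ok
  chain⁻¹-ok (suc m) ok = chain⁻¹-ok m (t-ok (suc m) ok)

  chain-chain⁻¹ : ∀ m {x} → Ok x → chain m (chain⁻¹ m x) ≡ x
  chain-chain⁻¹ zero    ok = refl
  chain-chain⁻¹ (suc m) {x} ok = begin
    t (suc m) (chain m (chain⁻¹ m (t (suc m) x))) ≡⟨ cong (t (suc m)) (chain-chain⁻¹ m (t-ok (suc m) ok)) ⟩
    t (suc m) (t (suc m) x)                       ≡⟨ t-involutive (suc m) ok ⟩
    x                                             ∎

  chain⁻¹-chain : ∀ m {x} → Ok x → chain⁻¹ m (chain m x) ≡ x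
  chain⁻¹-chain zero    ok = refl
  chain⁻¹-chain (suc m) {x} ok = begin
    chain⁻¹ m (t (suc m) (t (suc m) (chain m x))) ≡⟨ cong (chain⁻¹ m) (t-involutive (suc m) (chain-ok m ok)) ⟩
    chain⁻¹ m (chain m x)                         ≡⟨ chain⁻¹-chain m ok ⟩
    x                                             ∎

  t-chain-comm : ∀ m k → suc m < k → ∀ {x} → Ok x → t k (chain m x) ≡ chain m (t k x)
  t-chain-comm zero    k _ _ = refl
  t-chain-comm (suc m) k m<k {x} ok = begin
    t k (t (suc m) (chain m x))   ≡⟨ sym (t-comm (suc m) k m<k (chain-ok m ok)) ⟩
    t (suc m) (t k (chain m x))   ≡⟨ cong (t (suc m)) (t-chain-comm m k (ℕP.<-trans (ℕP.n<1+n _) m<k) ok) ⟩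
    t (suc m) (chain m (t k x))   ∎

  t-evac-comm : ∀ m k → suc m < k → ∀ {x} → Ok x → t k (evac m x) ≡ evac m (t k x)
  t-evac-comm zero    k _ _ = refl
  t-evac-comm (suc m) k m<k {x} ok = begin
    t k (evac m (chain (suc m) x)) ≡⟨ t-evac-comm m k (ℕP.<-trans (ℕP.n<1+n _) m<k) (chain-ok (suc m) ok) ⟩
    evac m (t k (chain (suc m) x)) ≡⟨ cong (evac m) (t-chain-comm (suc m) k m<k ok) ⟩
    evac m (chain (suc m) (t k x)) ∎

  evac-chain⁻¹ : ∀ m {x} → Ok x → evac (suc m) (chain⁻¹ (suc m) x) ≡ evac m x
  evac-chain⁻¹ m ok = cong (evac m) (chain-chain⁻¹ (suc m) ok)

  t-evac-chain⁻¹ : ∀ m {x} → Ok x → t (suc m) (evac m (chain⁻¹ m x)) ≡ evac m (chain⁻¹ m (t (suc m) x))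
  t-evac-chain⁻¹ zero    ok = refl
  t-evac-chain⁻¹ (suc m) {x} ok = begin
    t (suc (suc m)) (evac (suc m) (chain⁻¹ (suc m) x))       ≡⟨ cong (t (suc (suc m))) (evac-chain⁻¹ m ok) ⟩
    t (suc (suc m)) (evac m x)                               ≡⟨ t-evac-comm m (suc (suc m)) ℕP.≤-refl ok ⟩
    evac m (t (suc (suc m)) x)                               ≡⟨ sym (evac-chain⁻¹ m (t-ok (suc (suc m)) ok)) ⟩
    evac (suc m) (chain⁻¹ (suc m) (t (suc (suc m)) x))       ∎

  mutual
    chain-evac-chain : ∀ m {x} → Ok x → chain m (evac m (chain m x)) ≡ evac m x
    chain-evac-chain zero    ok = refl
    chain-evac-chain (suc m) {x} ok = begin
      chain (suc m) (evac m (chain (suc m) (chain (suc m) x)))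
        ≡⟨ chain-suc-evac m (chain-ok (suc m) (chain-ok (suc m) ok)) ⟩
      evac m (chain⁻¹ (suc m) (chain (suc m) (chain (suc m) x)))
        ≡⟨ cong (evac m) (chain⁻¹-chain (suc m) (chain-ok (suc m) ok)) ⟩
      evac m (chain (suc m) x) ∎

    chain-suc-evac : ∀ m {x} → Ok x → chain (suc m) (evac m x) ≡ evac m (chain⁻¹ (suc m) x)
    chain-suc-evac m {x} ok = begin
      t (suc m) (chain m (evac m x))
        ≡⟨ cong (λ y → t (suc m) (chain m (evac m y))) (sym (chain-chain⁻¹ m ok)) ⟩
      t (suc m) (chain m (evac m (chain m (chain⁻¹ m x))))
        ≡⟨ cong (t (suc m)) (chain-evac-chain m (chain⁻¹-ok m ok)) ⟩
      t (suc m) (evac m (chain⁻¹ m x))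
        ≡⟨ t-evac-chain⁻¹ m ok ⟩
      evac m (chain⁻¹ (suc m) x) ∎

  evac-involutive : ∀ m {x} → Ok x → evac m (evac m x) ≡ x
  evac-involutive zero    ok = refl
  evac-involutive (suc m) {x} ok = begin
    evac m (chain (suc m) (evac m (chain (suc m) x)))
      ≡⟨ cong (evac m) (chain-suc-evac m (chain-ok (suc m) ok)) ⟩
    evac m (evac m (chain⁻¹ (suc m) (chain (suc m) x)))
      ≡⟨ cong (λ y → evac m (evac m y)) (chain⁻¹-chain (suc m) ok) ⟩
    evac m (evac m x)
      ≡⟨ evac-involutive m ok ⟩
    x ∎

record LeastAbove (R : ℕ → Set) (k x : ℕ) : Set where
  field
    member : R x
    above  : k < x
    least  : ∀ {y} → R y → k < y → x ≤ y

∈⇒≤-foldr-⊔ : ∀ {x} xs → x ∈ xs → x ≤ foldr _⊔_ 0 xs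
∈⇒≤-foldr-⊔ xs x∈xs = foldr-preservesᵒ (λ a b → [ ℕP.m≤n⇒m≤n⊔o b , ℕP.m≤n⇒m≤o⊔n a ]′) 0 xs
                                        (inj₂ (Any.map ℕP.≤-reflexive x∈xs))

head-filter-above-least : ∀ {k x} xs → AllPairs _<_ xs → x ∈ xs → k < x →
                          LeastAbove (_∈ xs) k (maybe (λ y → y) 0 (head (filter (k ℕ.<?_) xs)))
head-filter-above-least {k} {x} xs sorted x∈xs k<x = least-of-head (filter (k ℕ.<?_) xs) refl
  where
  above-k : List ℕ
  above-k = filter (k ℕ.<?_) xs
  least-of-head : ∀ ys → ys ≡ above-k → LeastAbove (_∈ xs) k (maybe (λ y → y) 0 (head ys))
  least-of-head [] eq = ⊥-elim (¬Any[] (subst (x ∈_) (sym eq) (∈-filter⁺ (k ℕ.<?_) x∈xs k<x)))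
  least-of-head (h ∷ ys) eq = record
    { member = proj₁ (∈-filter⁻ (k ℕ.<?_) {xs = xs} h∈)
    ; above  = proj₂ (∈-filter⁻ (k ℕ.<?_) {xs = xs} h∈)
    ; least  = λ y∈xs k<y → h-least (subst (_ ∈_) (sym eq) (∈-filter⁺ (k ℕ.<?_) y∈xs k<y))
    }
    where
    h∈ : h ∈ above-k
    h∈ = subst (h ∈_) eq (here refl)
    h-least : ∀ {y} → y ∈ h ∷ ys → h ≤ y
    h-least (here refl) = ℕP.≤-refl
    h-least (there y∈) with subst (AllPairs _<_) (sym eq) (APP.filter⁺ (k ℕ.<?_) sorted)
    ... | h<ys ∷ _ = ℕP.<⇒≤ (LAll.lookup h<ys y∈)

⊔∸-mono-< : ∀ {a₁ a₂ b₁ b₂} c → a₁ < a₂ → b₁ < b₂ → a₁ ⊔ (b₁ ∸ c) < a₂ ⊔ (b₂ ∸ c)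
⊔∸-mono-< {a₁} {a₂} {b₁} {b₂} c a₁<a₂ b₁<b₂ =
  ℕP.⊔-pres-<m (ℕP.<-≤-trans a₁<a₂ (ℕP.m≤m⊔n a₂ _)) b₁∸c<
  where
  b₁∸c< : b₁ ∸ c < a₂ ⊔ (b₂ ∸ c)
  b₁∸c< with c ℕ.≤? b₁
  ... | yes c≤b₁ = ℕP.<-≤-trans (ℕP.∸-monoˡ-< b₁<b₂ c≤b₁) (ℕP.m≤n⊔m a₂ _)
  ... | no c≰b₁  = subst (_< a₂ ⊔ (b₂ ∸ c)) (sym (ℕP.m≤n⇒m∸n≡0 (ℕP.<⇒≤ (ℕP.≰⇒> c≰b₁))))
                     (ℕP.<-≤-trans (ℕP.≤-<-trans z≤n a₁<a₂) (ℕP.m≤m⊔n a₂ _))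

InPair : ℕ → ℕ → Set
InPair k x = k ≤ x × x ≤ suc k

≡⇒InPair : ∀ {k x} → x ≡ k → InPair k x
≡⇒InPair refl = ℕP.≤-refl , ℕP.n≤1+n _

≡suc⇒InPair : ∀ {k x} → x ≡ suc k → InPair k x
≡suc⇒InPair refl = ℕP.n≤1+n _ , ℕP.≤-refl

InPair-≢⇒≡suc : ∀ {k x} → InPair k x → x ≢ k → x ≡ suc k
InPair-≢⇒≡suc (k≤x , x≤suc) x≢k = ℕP.≤-antisym x≤suc (ℕP.≤∧≢⇒< k≤x (x≢k ∘ sym))

InPair-≢suc⇒≡ : ∀ {k x} → InPair k x → x ≢ suc k → x ≡ k
InPair-≢suc⇒≡ (k≤x , x≤suc) x≢suc = ℕP.≤-antisym (ℕP.≤-pred (ℕP.≤∧≢⇒< x≤suc x≢suc)) k≤x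

Far : ℕ → ℕ → Set
Far k k′ = suc k < k′ ⊎ suc k′ < k

Far-sym : ∀ {k k′} → Far k k′ → Far k′ k
Far-sym (inj₁ lt) = inj₂ lt
Far-sym (inj₂ lt) = inj₁ lt

Far⇒¬InPair : ∀ {k k′ x} → Far k k′ → InPair k x → ¬ InPair k′ x
Far⇒¬InPair (inj₁ k+1<k′) (_ , x≤k+1) (k′≤x , _) =
  ℕP.<-irrefl refl (ℕP.≤-<-trans x≤k+1 (ℕP.<-≤-trans k+1<k′ k′≤x))
Far⇒¬InPair (inj₂ k′+1<k) (k≤x , _) (_ , x≤k′+1) =
  ℕP.<-irrefl refl (ℕP.≤-<-trans x≤k′+1 (ℕP.<-≤-trans k′+1<k k≤x))

AgreeOutside : ℕ → ℕ → ℕ → Set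
AgreeOutside k′ x y = x ≡ y ⊎ (InPair k′ x × InPair k′ y)

AgreeOutside-sym : ∀ {k′ x y} → AgreeOutside k′ x y → AgreeOutside k′ y x
AgreeOutside-sym (inj₁ x≡y)          = inj₁ (sym x≡y)
AgreeOutside-sym (inj₂ (px , py))    = inj₂ (py , px)

AgreeOutside-¬InPair : ∀ {k′ x y} → ¬ InPair k′ x → AgreeOutside k′ x y → x ≡ y
AgreeOutside-¬InPair _   (inj₁ x≡y)       = x≡y
AgreeOutside-¬InPair ¬px (inj₂ (px , _))  = ⊥-elim (¬px px)

AgreeOutside-InPair : ∀ {k k′ x y} → Far k k′ → InPair k y → AgreeOutside k′ x y → x ≡ y
AgreeOutside-InPair far py x~y = sym (AgreeOutside-¬InPair (Far⇒¬InPair far py) (AgreeOutside-sym x~y))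

AgreeOutside-above : ∀ {k k′ x y} → Far k k′ → AgreeOutside k′ x y → suc k < x → suc k < y
AgreeOutside-above far (inj₁ refl) k+1<x = k+1<x
AgreeOutside-above (inj₁ k+1<k′) (inj₂ (_ , (k′≤y , _))) _ = ℕP.<-≤-trans k+1<k′ k′≤y
AgreeOutside-above (inj₂ k′+1<k) (inj₂ ((_ , x≤k′+1) , _)) k+1<x =
  ⊥-elim (ℕP.<-asym k+1<x (ℕP.≤-<-trans x≤k′+1 (ℕP.<-trans k′+1<k (ℕP.n<1+n _))))

AgreeOutside-below : ∀ {k k′ x y} → Far k k′ → AgreeOutside k′ x y → x < k → y < k
AgreeOutside-below far (inj₁ refl) x<k = x<k
AgreeOutside-below (inj₁ k+1<k′) (inj₂ ((k′≤x , _) , _)) x<k =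
  ⊥-elim (ℕP.<-asym x<k (ℕP.<-≤-trans (ℕP.<-trans (ℕP.n<1+n _) k+1<k′) k′≤x))
AgreeOutside-below (inj₂ k′+1<k) (inj₂ (_ , (_ , y≤k′+1))) _ = ℕP.≤-<-trans y≤k′+1 k′+1<k

fiber-tabulateD : ∀ {n} (L : Fin n → ℕ) g p → fiber (tabulateD L g) p ≡ g p
fiber-tabulateD {suc n} L g fz     = refl
fiber-tabulateD {suc n} L g (fs p) = fiber-tabulateD (λ p → L (fs p)) (λ p → g (fs p)) p

DVec-ext : ∀ {n} {L : Fin n → ℕ} {d e : DVec n L} → (∀ p → fiber d p ≡ fiber e p) → d ≡ e
DVec-ext {zero}                        h = refl
DVec-ext {suc n} {d = w , d} {w′ , e} h = cong₂ _,_ (h fz) (DVec-ext (λ p → h (fs p)))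

BoundedD-intro : ∀ q {n} {L : Fin n → ℕ} {d : DVec n L} → (∀ p → All (_≤ q) (fiber d p)) → BoundedD q d
BoundedD-intro q {zero}                h = tt
BoundedD-intro q {suc n} {d = w , d} h = h fz , BoundedD-intro q (λ p → h (fs p))

module BenderKnuth {n : ℕ} {_≼_ : Fin n → Fin n → Set} (po : IsDecPartialOrder _≡_ _≼_)
                   (ℓ q : ℕ) (u v : Fin n → ℕ) where

  -- Plain aliases instead of 'open Setup po ℓ q u v': conversion checks between terms built from
  -- module-application copies make Agda unfold ρ completely, which is prohibitively slow.
  _≺_ : Fin n → Fin n → Set
  _≺_ = Setup._≺_ po ℓ q u v
  len : Fin n → ℕ
  len = Setup.len po ℓ q u v
  Lab : Set
  Lab = Setup.Lab po ℓ q u v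
  val : Lab → (p : Fin n) → Fin (len p) → ℕ
  val = Setup.val po ℓ q u v
  StrictCond WeakCond : Lab → Set
  StrictCond = Setup.StrictCond po ℓ q u v
  WeakCond   = Setup.WeakCond po ℓ q u v
  RangeCond InL : (Fin n → ℕ → Set) → Lab → Set
  RangeCond = Setup.RangeCond po ℓ q u v
  InL       = Setup.InL po ℓ q u v
  Iq Rq : Fin n → ℕ → Set
  Iq = Setup.Iq po ℓ q u v
  Rq = Setup.Rq po ℓ q u v
  Rq? : ∀ p k → Dec (Rq p k)
  Rq? = Setup.Rq? po ℓ q u v
  Rlist : Fin n → List ℕ
  Rlist = Setup.Rlist po ℓ q u v
  maxR : Fin n → ℕ
  maxR = Setup.maxR po ℓ q u v
  nextR : Fin n → ℕ → ℕ
  nextR = Setup.nextR po ℓ q u v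
  update : Lab → (p : Fin n) → Vec ℕ (len p) → Lab
  update = Setup.update po ℓ q u v
  Raisable Lowerable : Lab → (p : Fin n) → Fin (len p) → Set
  Raisable  = Setup.Raisable po ℓ q u v
  Lowerable = Setup.Lowerable po ℓ q u v
  Free : ℕ → Lab → (p : Fin n) → Fin (len p) → Set
  Free = Setup.Free po ℓ q u v
  Free? : ∀ k f p j → Dec (Free k f p j)
  Free? = Setup.Free? po ℓ q u v
  countB : ℕ → Lab → Fin n → ℕ
  countB = Setup.countB po ℓ q u v
  freeBefore : ℕ → Lab → (p : Fin n) → Fin (len p) → ℕ
  freeBefore = Setup.freeBefore po ℓ q u v
  newFiber : ℕ → Lab → (p : Fin n) → Vec ℕ (len p)
  newFiber = Setup.newFiber po ℓ q u v
  Active? : ∀ p k → Dec (Rq p k × k ≢ maxR p)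
  Active? = Setup.Active? po ℓ q u v
  ρ chain evacAux : ℕ → Lab → Lab
  ρ       = Setup.ρ po ℓ q u v
  chain   = Setup.chain po ℓ q u v
  evacAux = Setup.evacAux po ℓ q u v
  Evac Pro : Lab → Lab
  Evac = Setup.Evac po ℓ q u v
  Pro  = Setup.Pro po ℓ q u v

  val-tabulateD : ∀ g p j → val (tabulateD len g) p j ≡ lookup (g p) j
  val-tabulateD g p j = cong (λ w → lookup w j) (fiber-tabulateD len g p)

  Lab-ext : ∀ {f g} → (∀ p j → val f p j ≡ val g p j) → f ≡ g
  Lab-ext f≗g = DVec-ext λ p → Pointwise-≡⇒≡ (ext (f≗g p))

  -- 'update' tabulates a where-bound function; the equation d ≡ tabulateD len g lets Agda infer it
  fiber-unfold : ∀ {d : Lab} {g} → d ≡ tabulateD len g → ∀ p → fiber d p ≡ g p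
  fiber-unfold refl = fiber-tabulateD len _

  val-update-same : ∀ f p w j → val (update f p w) p j ≡ lookup w j
  val-update-same f p w j rewrite fiber-unfold {update f p w} refl p with p FP.≟ p
  ... | yes refl = refl
  ... | no p≢p   = ⊥-elim (p≢p refl)

  val-update-other : ∀ f p w {p′} j → p′ ≢ p → val (update f p w) p′ j ≡ val f p′ j
  val-update-other f p w {p′} j p′≢p rewrite fiber-unfold {update f p w} refl p′ with p′ FP.≟ p
  ... | yes refl = ⊥-elim (p′≢p refl)
  ... | no _     = refl

  Rq⇒Iq : ∀ {p k} → Rq p k → Iq p k
  Rq⇒Iq (f , _ , (_ , _ , f∈Iq) , j , refl) = f∈Iq _ j

  InL-Rq⇒Iq : ∀ {f} → InL Rq f → InL Iq f
  InL-Rq⇒Iq (strict , weak , range) = strict , weak , λ p j → Rq⇒Iq (range p j)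

  InL-Iq⇒BoundedD : ∀ {f} → InL Iq f → BoundedD q f
  InL-Iq⇒BoundedD (_ , _ , range) = BoundedD-intro q λ p → AllP.lookup⁻ λ j → proj₂ (range p j)

  -- R^q(p) is an interval

  _⊔[_∸_] : Lab → Lab → ℕ → Lab
  f ⊔[ g ∸ c ] = tabulateD len λ p → Vec.tabulate λ j → val f p j ⊔ (val g p j ∸ c)

  val-⊔∸ : ∀ f g c p j → val (f ⊔[ g ∸ c ]) p j ≡ val f p j ⊔ (val g p j ∸ c)
  val-⊔∸ f g c p j = trans (val-tabulateD _ p j) (VecP.lookup∘tabulate _ j)

  ⊔∸-InL : ∀ {f g} c → InL Iq f → InL Iq g → InL Iq (f ⊔[ g ∸ c ])
  ⊔∸-InL {f} {g} c (strictf , weakf , rangef) (strictg , weakg , rangeg) = strict , weak , range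
    where
    strict : StrictCond (f ⊔[ g ∸ c ])
    strict p₁ p₂ p₁≺p₂ j₁ j₂ same-i rewrite val-⊔∸ f g c p₁ j₁ | val-⊔∸ f g c p₂ j₂ =
      ⊔∸-mono-< c (strictf p₁ p₂ p₁≺p₂ j₁ j₂ same-i) (strictg p₁ p₂ p₁≺p₂ j₁ j₂ same-i)
    weak : WeakCond (f ⊔[ g ∸ c ])
    weak p j₁ j₂ j₁≤j₂ rewrite val-⊔∸ f g c p j₁ | val-⊔∸ f g c p j₂ =
      ℕP.⊔-mono-≤ (weakf p j₁ j₂ j₁≤j₂) (ℕP.∸-monoˡ-≤ c (weakg p j₁ j₂ j₁≤j₂))
    range : RangeCond Iq (f ⊔[ g ∸ c ])
    range p j rewrite val-⊔∸ f g c p j =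
      ℕP.≤-trans (proj₁ (rangef p j)) (ℕP.m≤m⊔n _ _) ,
      ℕP.⊔-lub (proj₂ (rangef p j)) (ℕP.≤-trans (ℕP.m∸n≤m _ c) (proj₂ (rangeg p j)))

  -- the witness is f ⊔ (g ∸ (g(p,j) ∸ m)), which reads m at (p,j)
  Rq-interval : ∀ {f g p j m} → InL Iq f → InL Iq g → val f p j ≤ m → m ≤ val g p j → Rq p m
  Rq-interval {f} {g} {p} {j} {m} f∈L g∈L f≤m m≤g =
    h , InL-Iq⇒BoundedD h∈L , h∈L , j , (begin
      val h p j                               ≡⟨ val-⊔∸ f g c p j ⟩
      val f p j ⊔ (val g p j ∸ (val g p j ∸ m)) ≡⟨ cong (val f p j ⊔_) (ℕP.m∸[m∸n]≡n m≤g) ⟩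
      val f p j ⊔ m                           ≡⟨ ℕP.m≤n⇒m⊔n≡n f≤m ⟩
      m                                       ∎)
    where
    open ≡-Reasoning
    c : ℕ
    c = val g p j ∸ m
    h : Lab
    h = f ⊔[ g ∸ c ]
    h∈L : InL Iq h
    h∈L = ⊔∸-InL c f∈L g∈L

  Active : Fin n → ℕ → Set
  Active p k = Rq p k × k ≢ maxR p

  ∈-Rlist⁺ : ∀ {p x} → Rq p x → x ∈ Rlist p
  ∈-Rlist⁺ {p} x∈R = ∈-filter⁺ (Rq? p) (∈-upTo⁺ (s≤s (proj₂ (Rq⇒Iq x∈R)))) x∈R

  ∈-Rlist⁻ : ∀ {p x} → x ∈ Rlist p → Rq p x
  ∈-Rlist⁻ {p} x∈ = proj₂ (∈-filter⁻ (Rq? p) x∈)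

  Rlist-sorted : ∀ p → AllPairs _<_ (Rlist p)
  Rlist-sorted p = APP.filter⁺ (Rq? p) (APP.applyUpTo⁺₁ (λ x → x) (suc q) (λ i<j _ → i<j))

  Active⇒<maxR : ∀ {p k} → Active p k → k < maxR p
  Active⇒<maxR {p} (k∈R , k≢max) = ℕP.≤∧≢⇒< (∈⇒≤-foldr-⊔ (Rlist p) (∈-Rlist⁺ k∈R)) k≢max

  Active⇒maxR∈Rlist : ∀ {p k} → Active p k → maxR p ∈ Rlist p
  Active⇒maxR∈Rlist {p} {k} act =
    [ (λ max≡0 → ⊥-elim (ℕP.n≮0 (subst (k <_) max≡0 (Active⇒<maxR act)))) , (λ max∈ → max∈) ]′
      (foldr-selective ℕP.⊔-sel 0 (Rlist p))

  nextR-leastAbove : ∀ {p k} → Active p k → LeastAbove (Rq p) k (nextR p k)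
  nextR-leastAbove {p} {k} act = record
    { member = ∈-Rlist⁻ (member least-in-list)
    ; above  = above least-in-list
    ; least  = λ y∈R → least least-in-list (∈-Rlist⁺ y∈R)
    }
    where
    open LeastAbove
    least-in-list : LeastAbove (_∈ Rlist p) k (nextR p k)
    least-in-list = head-filter-above-least (Rlist p) (Rlist-sorted p) (Active⇒maxR∈Rlist act) (Active⇒<maxR act)

  -- Free labels, locally

  UpperNeighboursAbove : Lab → (p : Fin n) → Fin (len p) → ℕ → Set
  UpperNeighboursAbove f p j x =
    ∀ p′ → p ≺ p′ → ∀ j′ → u p + toℕ j ≡ u p′ + toℕ j′ → x < val f p′ j′

  LowerNeighboursBelow : Lab → (p : Fin n) → Fin (len p) → ℕ → Set
  LowerNeighboursBelow f p j x =
    ∀ p′ → p′ ≺ p → ∀ j′ → u p′ + toℕ j′ ≡ u p + toℕ j → val f p′ j′ < x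

  strict⇒upper : ∀ {f} → StrictCond f → ∀ p j → UpperNeighboursAbove f p j (val f p j)
  strict⇒upper strictf p j p′ p≺p′ j′ = strictf p p′ p≺p′ j j′

  strict⇒lower : ∀ {f} → StrictCond f → ∀ p j → LowerNeighboursBelow f p j (val f p j)
  strict⇒lower strictf p j p′ p′≺p j′ = strictf p′ p p′≺p j′ j

  -- raising the k at (p,j) to k+1 forces raising every k after it in F_p as well
  LocallyRaisable : ℕ → Lab → (p : Fin n) → Fin (len p) → Set
  LocallyRaisable k f p j =
    val f p j ≡ k × (∀ j′ → j F.≤ j′ → val f p j′ ≡ k → UpperNeighboursAbove f p j′ (suc k))

  LocallyLowerable : ℕ → Lab → (p : Fin n) → Fin (len p) → Set
  LocallyLowerable k f p j =
    val f p j ≡ suc k × (∀ j′ → j′ F.≤ j → val f p j′ ≡ suc k → LowerNeighboursBelow f p j′ k)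

  LocallyFree : ℕ → Lab → (p : Fin n) → Fin (len p) → Set
  LocallyFree k f p j = LocallyRaisable k f p j ⊎ LocallyLowerable k f p j

  -- R^q(p) is an interval, so a label that can move from k towards R(p)_{>k} proves k+1 ∈ R^q(p)
  free⇒nextR≡suc : ∀ {k f p j} → InL Rq f → Active p k → Free k f p j → nextR p k ≡ suc k
  free⇒nextR≡suc {k} {f} {p} {j} f∈L act free =
    ℕP.≤-antisym (least (suc∈R free) ℕP.≤-refl) above
    where
    open LeastAbove (nextR-leastAbove act)
    suc∈R : Free k f p j → Rq p (suc k)
    suc∈R (inj₁ (f≡k , w , _ , g∈L , f<w)) =
      Rq-interval (InL-Rq⇒Iq f∈L) (InL-Rq⇒Iq g∈L) (subst (_≤ suc k) (sym f≡k) (ℕP.n≤1+n k))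
        (subst (suc k ≤_) (sym (val-update-same f p w j)) (subst (_< lookup w j) f≡k f<w))
    suc∈R (inj₂ (f≡next , w , _ , g∈L , w<f)) =
      Rq-interval (InL-Rq⇒Iq g∈L) (InL-Rq⇒Iq f∈L) g≤suc (subst (suc k ≤_) (sym f≡next) above)
      where
      g<next : val (update f p w) p j < nextR p k
      g<next = subst (_< nextR p k) (sym (val-update-same f p w j)) (subst (lookup w j <_) f≡next w<f)
      g≤suc : val (update f p w) p j ≤ suc k
      g≤suc = by-cases (k ℕ.<? val (update f p w) p j)
        where
        by-cases : Dec (k < val (update f p w) p j) → val (update f p w) p j ≤ suc k
        by-cases (no k≮g)  = ℕP.m≤n⇒m≤1+n (ℕP.≮⇒≥ k≮g)
        by-cases (yes k<g) = ⊥-elim (ℕP.<⇒≱ g<next (least (proj₂ (proj₂ g∈L) p j) k<g))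

  ≺⇒≢ : ∀ {p p′} → p ≺ p′ → p′ ≢ p
  ≺⇒≢ (_ , p≢p′) p′≡p = p≢p′ (sym p′≡p)

  Raisable⇒LocallyRaisable : ∀ {k f p j} → val f p j ≡ k → Raisable f p j → LocallyRaisable k f p j
  Raisable⇒LocallyRaisable {k} {f} {p} {j} f≡k (w , _ , (strictg , weakg , _) , f<w) = f≡k , upper
    where
    g : Lab
    g = update f p w
    upper : ∀ j′ → j F.≤ j′ → val f p j′ ≡ k → UpperNeighboursAbove f p j′ (suc k)
    upper j′ j≤j′ _ p′ p≺p′ j″ same-i = ℕP.≤-<-trans
      (ℕP.<-≤-trans (subst₂ _<_ f≡k (sym (val-update-same f p w j)) f<w) (weakg p j j′ j≤j′))
      (subst (val g p j′ <_) (val-update-other f p w j″ (≺⇒≢ p≺p′)) (strictg p p′ p≺p′ j′ j″ same-i))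

  Lowerable⇒LocallyLowerable : ∀ {k f p j} → val f p j ≡ suc k → Lowerable f p j → LocallyLowerable k f p j
  Lowerable⇒LocallyLowerable {k} {f} {p} {j} f≡suc (w , _ , (strictg , weakg , _) , w<f) = f≡suc , lower
    where
    g : Lab
    g = update f p w
    lower : ∀ j′ → j′ F.≤ j → val f p j′ ≡ suc k → LowerNeighboursBelow f p j′ k
    lower j′ j′≤j _ p′ p′≺p j″ same-i = ℕP.<-≤-trans
      (subst (_< val g p j′) (val-update-other f p w j″ (≺⇒≢ p′≺p ∘ sym))
             (strictg p′ p p′≺p j″ j′ same-i))
      (ℕP.≤-pred (ℕP.≤-<-trans (weakg p j′ j j′≤j) (subst₂ _<_ (sym (val-update-same f p w j)) f≡suc w<f)))

  Rq⇒All≤q : ∀ {p} {w : Vec ℕ (len p)} → (∀ i → Rq p (lookup w i)) → All (_≤ q) w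
  Rq⇒All≤q w∈R = AllP.lookup⁻ λ i → proj₂ (Rq⇒Iq (w∈R i))

  update-InL : ∀ {f p} {w : Vec ℕ (len p)} → InL Rq f →
               (∀ i₁ i₂ → i₁ F.≤ i₂ → lookup w i₁ ≤ lookup w i₂) →
               (∀ i → Rq p (lookup w i)) →
               (∀ i → LowerNeighboursBelow f p i (lookup w i)) →
               (∀ i → UpperNeighboursAbove f p i (lookup w i)) →
               InL Rq (update f p w)
  update-InL {f} {p} {w} (strictf , weakf , rangef) weakw rangew lower upper = strict , weak , range
    where
    strict : StrictCond (update f p w)
    strict p₁ p₂ p₁≺p₂ j₁ j₂ same-i with p₁ FP.≟ p | p₂ FP.≟ p
    ... | yes refl | yes refl = ⊥-elim (proj₂ p₁≺p₂ refl)
    ... | yes refl | no p₂≢p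
      rewrite val-update-same f p w j₁ | val-update-other f p w j₂ p₂≢p = upper j₁ p₂ p₁≺p₂ j₂ same-i
    ... | no p₁≢p  | yes refl
      rewrite val-update-other f p w j₁ p₁≢p | val-update-same f p w j₂ = lower j₂ p₁ p₁≺p₂ j₁ same-i
    ... | no p₁≢p  | no p₂≢p
      rewrite val-update-other f p w j₁ p₁≢p | val-update-other f p w j₂ p₂≢p =
        strictf p₁ p₂ p₁≺p₂ j₁ j₂ same-i
    weak : WeakCond (update f p w)
    weak p′ i₁ i₂ i₁≤i₂ with p′ FP.≟ p
    ... | yes refl rewrite val-update-same f p w i₁ | val-update-same f p w i₂ = weakw i₁ i₂ i₁≤i₂
    ... | no p′≢p
      rewrite val-update-other f p w i₁ p′≢p | val-update-other f p w i₂ p′≢p = weakf p′ i₁ i₂ i₁≤i₂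
    range : RangeCond Rq (update f p w)
    range p′ i with p′ FP.≟ p
    ... | yes refl rewrite val-update-same f p w i = rangew i
    ... | no p′≢p  rewrite val-update-other f p w i p′≢p = rangef p′ i

  module _ (f : Lab) (p : Fin n) {C : Pred (Fin (len p)) 0ℓ} (C? : Decidable C) (x : ℕ) where

    replaceWhere : Vec ℕ (len p)
    replaceWhere = Vec.tabulate λ i → if does (C? i) then x else val f p i

    replaceWhere-view : ∀ i → (C i × lookup replaceWhere i ≡ x) ⊎ (¬ C i × lookup replaceWhere i ≡ val f p i)
    replaceWhere-view i rewrite VecP.lookup∘tabulate (λ i → if does (C? i) then x else val f p i) i with C? i
    ... | yes c = inj₁ (c , refl)
    ... | no ¬c = inj₂ (¬c , refl)

    replaceWhere-Rq : InL Rq f → Rq p x → ∀ i → Rq p (lookup replaceWhere i)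
    replaceWhere-Rq (_ , _ , rangef) x∈R i with replaceWhere-view i
    ... | inj₁ (_ , r≡x) = subst (Rq p) (sym r≡x) x∈R
    ... | inj₂ (_ , r≡f) = subst (Rq p) (sym r≡f) (rangef p i)

  LocallyRaisable⇒Raisable : ∀ {k f p j} → InL Rq f → Rq p (suc k) → LocallyRaisable k f p j → Raisable f p j
  LocallyRaisable⇒Raisable {k} {f} {p} {j} f∈L@(strictf , weakf , _) suc∈R (f≡k , upper) =
    w , Rq⇒All≤q w∈R , update-InL f∈L weak w∈R lower upper′ , f<w
    where
    C : Pred (Fin (len p)) 0ℓ
    C i = j F.≤ i × val f p i ≡ k
    C? : Decidable C
    C? i = (j F.≤? i) ×-dec (val f p i ℕ.≟ k)
    w : Vec ℕ (len p)
    w = replaceWhere f p C? (suc k)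
    view : ∀ i → (C i × lookup w i ≡ suc k) ⊎ (¬ C i × lookup w i ≡ val f p i)
    view = replaceWhere-view f p C? (suc k)
    w∈R : ∀ i → Rq p (lookup w i)
    w∈R = replaceWhere-Rq f p C? (suc k) f∈L suc∈R
    f≤w : ∀ i → val f p i ≤ lookup w i
    f≤w i with view i
    ... | inj₁ ((_ , fi≡k) , w≡) = subst₂ _≤_ (sym fi≡k) (sym w≡) (ℕP.n≤1+n k)
    ... | inj₂ (_ , w≡)          = ℕP.≤-reflexive (sym w≡)
    weak : ∀ i₁ i₂ → i₁ F.≤ i₂ → lookup w i₁ ≤ lookup w i₂
    weak i₁ i₂ i₁≤i₂ with view i₁ | view i₂
    ... | inj₁ (_ , w₁≡) | inj₁ (_ , w₂≡) = ℕP.≤-reflexive (trans w₁≡ (sym w₂≡))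
    ... | inj₁ ((j≤i₁ , f₁≡k) , w₁≡) | inj₂ (¬C₂ , w₂≡) = subst₂ _≤_ (sym w₁≡) (sym w₂≡)
          (ℕP.≤∧≢⇒< (subst (_≤ val f p i₂) f₁≡k (weakf p i₁ i₂ i₁≤i₂))
                     λ k≡f₂ → ¬C₂ (ℕP.≤-trans j≤i₁ i₁≤i₂ , sym k≡f₂))
    ... | inj₂ (_ , w₁≡) | inj₁ ((_ , f₂≡k) , w₂≡) = subst₂ _≤_ (sym w₁≡) (sym w₂≡)
          (ℕP.m≤n⇒m≤1+n (subst (val f p i₁ ≤_) f₂≡k (weakf p i₁ i₂ i₁≤i₂)))
    ... | inj₂ (_ , w₁≡) | inj₂ (_ , w₂≡) = subst₂ _≤_ (sym w₁≡) (sym w₂≡) (weakf p i₁ i₂ i₁≤i₂)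
    lower : ∀ i → LowerNeighboursBelow f p i (lookup w i)
    lower i p′ p′≺p i′ same-i = ℕP.<-≤-trans (strictf p′ p p′≺p i′ i same-i) (f≤w i)
    upper′ : ∀ i → UpperNeighboursAbove f p i (lookup w i)
    upper′ i with view i
    ... | inj₁ ((j≤i , fi≡k) , w≡) = subst (UpperNeighboursAbove f p i) (sym w≡) (upper i j≤i fi≡k)
    ... | inj₂ (_ , w≡) = subst (UpperNeighboursAbove f p i) (sym w≡) (strict⇒upper strictf p i)
    f<w : val f p j < lookup w j
    f<w with view j
    ... | inj₁ (_ , w≡)  = subst₂ _<_ (sym f≡k) (sym w≡) (ℕP.n<1+n k)
    ... | inj₂ (¬C , _) = ⊥-elim (¬C (FP.≤-refl , f≡k))

  LocallyLowerable⇒Lowerable : ∀ {k f p j} → InL Rq f → Rq p k → LocallyLowerable k f p j → Lowerable f p j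
  LocallyLowerable⇒Lowerable {k} {f} {p} {j} f∈L@(strictf , weakf , _) k∈R (f≡suc , lower) =
    w , Rq⇒All≤q w∈R , update-InL f∈L weak w∈R lower′ upper , w<f
    where
    C : Pred (Fin (len p)) 0ℓ
    C i = i F.≤ j × val f p i ≡ suc k
    C? : Decidable C
    C? i = (i F.≤? j) ×-dec (val f p i ℕ.≟ suc k)
    w : Vec ℕ (len p)
    w = replaceWhere f p C? k
    view : ∀ i → (C i × lookup w i ≡ k) ⊎ (¬ C i × lookup w i ≡ val f p i)
    view = replaceWhere-view f p C? k
    w∈R : ∀ i → Rq p (lookup w i)
    w∈R = replaceWhere-Rq f p C? k f∈L k∈R
    w≤f : ∀ i → lookup w i ≤ val f p i
    w≤f i with view i
    ... | inj₁ ((_ , fi≡suc) , w≡) = subst₂ _≤_ (sym w≡) (sym fi≡suc) (ℕP.n≤1+n k)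
    ... | inj₂ (_ , w≡)            = ℕP.≤-reflexive w≡
    weak : ∀ i₁ i₂ → i₁ F.≤ i₂ → lookup w i₁ ≤ lookup w i₂
    weak i₁ i₂ i₁≤i₂ with view i₁ | view i₂
    ... | inj₁ (_ , w₁≡) | inj₁ (_ , w₂≡) = ℕP.≤-reflexive (trans w₁≡ (sym w₂≡))
    ... | inj₁ ((_ , f₁≡suc) , w₁≡) | inj₂ (_ , w₂≡) = subst₂ _≤_ (sym w₁≡) (sym w₂≡)
          (ℕP.≤-trans (ℕP.n≤1+n k) (subst (_≤ val f p i₂) f₁≡suc (weakf p i₁ i₂ i₁≤i₂)))
    ... | inj₂ (¬C₁ , w₁≡) | inj₁ ((i₂≤j , f₂≡suc) , w₂≡) = subst₂ _≤_ (sym w₁≡) (sym w₂≡)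
          (ℕP.≤-pred (ℕP.≤∧≢⇒< (subst (val f p i₁ ≤_) f₂≡suc (weakf p i₁ i₂ i₁≤i₂))
                                λ f₁≡suc → ¬C₁ (ℕP.≤-trans i₁≤i₂ i₂≤j , f₁≡suc)))
    ... | inj₂ (_ , w₁≡) | inj₂ (_ , w₂≡) = subst₂ _≤_ (sym w₁≡) (sym w₂≡) (weakf p i₁ i₂ i₁≤i₂)
    upper : ∀ i → UpperNeighboursAbove f p i (lookup w i)
    upper i p′ p≺p′ i′ same-i = ℕP.≤-<-trans (w≤f i) (strictf p p′ p≺p′ i i′ same-i)
    lower′ : ∀ i → LowerNeighboursBelow f p i (lookup w i)
    lower′ i with view i
    ... | inj₁ ((i≤j , fi≡suc) , w≡) = subst (LowerNeighboursBelow f p i) (sym w≡) (lower i i≤j fi≡suc)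
    ... | inj₂ (_ , w≡) = subst (LowerNeighboursBelow f p i) (sym w≡) (strict⇒lower strictf p i)
    w<f : lookup w j < val f p j
    w<f with view j
    ... | inj₁ (_ , w≡)  = subst₂ _<_ (sym w≡) (sym f≡suc) (ℕP.n<1+n k)
    ... | inj₂ (¬C , _) = ⊥-elim (¬C (FP.≤-refl , f≡suc))

  Free⇒LocallyFree : ∀ {k f p j} → nextR p k ≡ suc k → Free k f p j → LocallyFree k f p j
  Free⇒LocallyFree next≡ (inj₁ (f≡k , raisable)) = inj₁ (Raisable⇒LocallyRaisable f≡k raisable)
  Free⇒LocallyFree next≡ (inj₂ (f≡next , lowerable)) =
    inj₂ (Lowerable⇒LocallyLowerable (trans f≡next next≡) lowerable)

  LocallyFree⇒Free : ∀ {k f p j} → InL Rq f → Active p k → nextR p k ≡ suc k → LocallyFree k f p j → Free k f p j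
  LocallyFree⇒Free {p = p} f∈L act next≡ (inj₁ raisable) =
    inj₁ (proj₁ raisable , LocallyRaisable⇒Raisable f∈L suc∈R raisable)
    where
    suc∈R : Rq p (suc _)
    suc∈R = subst (Rq p) next≡ (LeastAbove.member (nextR-leastAbove act))
  LocallyFree⇒Free f∈L act next≡ (inj₂ lowerable) =
    inj₂ (trans (proj₁ lowerable) (sym next≡) , LocallyLowerable⇒Lowerable f∈L (proj₁ act) lowerable)

  -- ρ_k is an involution of L(u,v,R^q)

  newLabel : ℕ → Lab → (p : Fin n) → Fin (len p) → ℕ
  newLabel k f p j = if does (freeBefore k f p j ℕ.<? countB k f p) then k else nextR p k

  val-ρ-inactive : ∀ {k f p} j → ¬ Active p k → val (ρ k f) p j ≡ val f p j
  val-ρ-inactive {k} {f} {p} j ¬act = trans (val-tabulateD _ p j)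
    (cong (λ b → lookup (if b then newFiber k f p else fiber f p) j) (dec-false (Active? p k) ¬act))

  val-ρ-active : ∀ {k f p} j → Active p k →
                 val (ρ k f) p j ≡ (if does (Free? k f p j) then newLabel k f p j else val f p j)
  val-ρ-active {k} {f} {p} j act = trans (val-tabulateD _ p j) (trans
    (cong (λ b → lookup (if b then newFiber k f p else fiber f p) j) (dec-true (Active? p k) act))
    (VecP.lookup∘tabulate _ j))

  ρ-fixed : ∀ {k f p j} → ¬ (Active p k × Free k f p j) → val (ρ k f) p j ≡ val f p j
  ρ-fixed {k} {f} {p} {j} ¬moved = by-activity (Active? p k)
    where
    by-activity : Dec (Active p k) → val (ρ k f) p j ≡ val f p j
    by-activity (no ¬act) = val-ρ-inactive j ¬act
    by-activity (yes act) = trans (val-ρ-active j act)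
      (cong (if_then newLabel k f p j else val f p j) (dec-false (Free? k f p j) λ free → ¬moved (act , free)))

  ρ-moved : ∀ {k f p j} → Active p k → Free k f p j → val (ρ k f) p j ≡ newLabel k f p j
  ρ-moved {k} {f} {p} {j} act free =
    trans (val-ρ-active j act) (cong (if_then newLabel k f p j else val f p j) (dec-true (Free? k f p j) free))

  LocallyFree⇒InPair : ∀ {k f p j} → LocallyFree k f p j → InPair k (val f p j)
  LocallyFree⇒InPair (inj₁ (f≡k , _))   = ≡⇒InPair f≡k
  LocallyFree⇒InPair (inj₂ (f≡suc , _)) = ≡suc⇒InPair f≡suc

  LocallyFree⇒upper : ∀ {k f p j} → InL Rq f → LocallyFree k f p j → UpperNeighboursAbove f p j (suc k)
  LocallyFree⇒upper _ (inj₁ (f≡k , upper)) = upper _ FP.≤-refl f≡k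
  LocallyFree⇒upper {f = f} {p} {j} (strictf , _) (inj₂ (f≡suc , _)) =
    subst (UpperNeighboursAbove f p j) f≡suc (strict⇒upper strictf p j)

  LocallyFree⇒lower : ∀ {k f p j} → InL Rq f → LocallyFree k f p j → LowerNeighboursBelow f p j k
  LocallyFree⇒lower {f = f} {p = p} {j} (strictf , _) (inj₁ (f≡k , _)) =
    subst (LowerNeighboursBelow f p j) f≡k (strict⇒lower strictf p j)
  LocallyFree⇒lower _ (inj₂ (f≡suc , lower)) = lower _ FP.≤-refl f≡suc

  LocallyRaisable-later : ∀ {k f p i i′} → LocallyRaisable k f p i → i F.≤ i′ → val f p i′ ≡ k →
                          LocallyRaisable k f p i′
  LocallyRaisable-later (_ , upper) i≤i′ f≡k =
    f≡k , λ j′ i′≤j′ → upper j′ (FP.≤-trans i≤i′ i′≤j′)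

  LocallyLowerable-earlier : ∀ {k f p i i′} → LocallyLowerable k f p i → i′ F.≤ i → val f p i′ ≡ suc k →
                             LocallyLowerable k f p i′
  LocallyLowerable-earlier (_ , lower) i′≤i f≡suc =
    f≡suc , λ j′ j′≤i′ → lower j′ (FP.≤-trans j′≤i′ i′≤i)

  freeBefore≡rank : ∀ k f p j → freeBefore k f p j ≡ rank (Free? k f p) j
  freeBefore≡rank k f p j = length-filter-allFin (Free? k f p ∩? (F._<? j))

  freeBefore-cong : ∀ {k f g p} → (∀ j → Free k f p j → Free k g p j) → (∀ j → Free k g p j → Free k f p j) →
                    ∀ j → freeBefore k f p j ≡ freeBefore k g p j
  freeBefore-cong {k} {f} {g} {p} f⊆g g⊆f j = begin
    freeBefore k f p j       ≡⟨ freeBefore≡rank k f p j ⟩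
    rank (Free? k f p) j     ≡⟨ rank-cong (Free? k f p) (Free? k g p) (f⊆g _) (g⊆f _) j ⟩
    rank (Free? k g p) j     ≡⟨ sym (freeBefore≡rank k g p j) ⟩
    freeBefore k g p j       ∎
    where open ≡-Reasoning

  AtNext? : ∀ k f p → Decidable (λ j → val f p j ≡ nextR p k)
  AtNext? k f p j = val f p j ℕ.≟ nextR p k

  countB≡count : ∀ k f p → countB k f p ≡ count (Free? k f p ∩? AtNext? k f p)
  countB≡count k f p = length-filter-allFin (Free? k f p ∩? AtNext? k f p)

  newLabel-below : ∀ {k f p j} → freeBefore k f p j < countB k f p → newLabel k f p j ≡ k
  newLabel-below {k} {f} {p} {j} lt = cong (if_then k else nextR p k) (dec-true (_ ℕ.<? _) lt)

  newLabel-above : ∀ {k f p j} → ¬ freeBefore k f p j < countB k f p → newLabel k f p j ≡ nextR p k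
  newLabel-above {k} {f} {p} {j} ¬lt = cong (if_then k else nextR p k) (dec-false (_ ℕ.<? _) ¬lt)

  newLabel-InPair : ∀ {k f p} j → nextR p k ≡ suc k → InPair k (newLabel k f p j)
  newLabel-InPair {k} {f} {p} j next≡ = by-cases (freeBefore k f p j ℕ.<? countB k f p)
    where
    by-cases : Dec (freeBefore k f p j < countB k f p) → InPair k (newLabel k f p j)
    by-cases (yes lt) = ≡⇒InPair (newLabel-below lt)
    by-cases (no ¬lt) = ≡suc⇒InPair (trans (newLabel-above ¬lt) next≡)

  newLabel-mono : ∀ {k f p i₁ i₂} → nextR p k ≡ suc k → i₁ F.≤ i₂ →
                  newLabel k f p i₁ ≤ newLabel k f p i₂
  newLabel-mono {k} {f} {p} {i₁} {i₂} next≡ i₁≤i₂ = by-cases (freeBefore k f p i₂ ℕ.<? countB k f p)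
    where
    before-mono : freeBefore k f p i₁ ≤ freeBefore k f p i₂
    before-mono = subst₂ _≤_ (sym (freeBefore≡rank k f p i₁)) (sym (freeBefore≡rank k f p i₂))
                    (rank-mono (Free? k f p) i₁≤i₂)
    by-cases : Dec (freeBefore k f p i₂ < countB k f p) → newLabel k f p i₁ ≤ newLabel k f p i₂
    by-cases (yes lt) = ℕP.≤-reflexive (trans (newLabel-below (ℕP.≤-<-trans before-mono lt)) (sym (newLabel-below lt)))
    by-cases (no ¬lt) = subst (newLabel k f p i₁ ≤_) (sym (trans (newLabel-above ¬lt) next≡))
                          (proj₂ (newLabel-InPair i₁ next≡))

  data ρView (k : ℕ) (f : Lab) (p : Fin n) (j : Fin (len p)) : Set where
    fixed : ¬ (Active p k × Free k f p j) → val (ρ k f) p j ≡ val f p j → ρView k f p j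
    moved : Active p k → Free k f p j → nextR p k ≡ suc k → LocallyFree k f p j →
            val (ρ k f) p j ≡ newLabel k f p j → ρView k f p j

  ρ-view : ∀ {k f} → InL Rq f → ∀ p j → ρView k f p j
  ρ-view {k} {f} f∈L p j = by-cases (Active? p k) (Free? k f p j)
    where
    by-cases : Dec (Active p k) → Dec (Free k f p j) → ρView k f p j
    by-cases (yes act) (yes free) =
      moved act free next≡ (Free⇒LocallyFree next≡ free) (ρ-moved act free)
      where
      next≡ : nextR p k ≡ suc k
      next≡ = free⇒nextR≡suc f∈L act free
    by-cases (no ¬act) _         = fixed (¬act ∘ proj₁) (ρ-fixed (¬act ∘ proj₁))
    by-cases _         (no ¬free) = fixed (¬free ∘ proj₂) (ρ-fixed (¬free ∘ proj₂))

  ρ-strict : ∀ {k f} → InL Rq f → StrictCond (ρ k f)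
  ρ-strict {k} {f} f∈L@(strictf , _) p₁ p₂ p₁≺p₂ j₁ j₂ same-i =
    by-views (ρ-view f∈L p₁ j₁) (ρ-view f∈L p₂ j₂)
    where
    by-views : ρView k f p₁ j₁ → ρView k f p₂ j₂ → val (ρ k f) p₁ j₁ < val (ρ k f) p₂ j₂
    by-views (fixed _ e₁) (fixed _ e₂) = subst₂ _<_ (sym e₁) (sym e₂) (strictf p₁ p₂ p₁≺p₂ j₁ j₂ same-i)
    by-views (moved _ _ next≡ free₁ e₁) (fixed _ e₂) = subst₂ _<_ (sym e₁) (sym e₂)
      (ℕP.≤-<-trans (proj₂ (newLabel-InPair j₁ next≡)) (LocallyFree⇒upper f∈L free₁ p₂ p₁≺p₂ j₂ same-i))
    by-views (moved _ _ _ free₁ _) (moved _ _ _ free₂ _) = ⊥-elim (ℕP.<-irrefl refl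
      (ℕP.<-≤-trans (LocallyFree⇒upper f∈L free₁ p₂ p₁≺p₂ j₂ same-i)
                    (proj₂ (LocallyFree⇒InPair free₂))))
    by-views (fixed _ e₁) (moved _ _ next≡ free₂ e₂) = subst₂ _<_ (sym e₁) (sym e₂)
      (ℕP.<-≤-trans (LocallyFree⇒lower f∈L free₂ p₁ p₁≺p₂ j₁ same-i) (proj₁ (newLabel-InPair j₂ next≡)))

  ρ-weak : ∀ {k f} → InL Rq f → WeakCond (ρ k f)
  ρ-weak {k} {f} f∈L@(_ , weakf , _) p i₁ i₂ i₁≤i₂ = by-views (ρ-view f∈L p i₁) (ρ-view f∈L p i₂)
    where
    f₁≤f₂ : val f p i₁ ≤ val f p i₂
    f₁≤f₂ = weakf p i₁ i₂ i₁≤i₂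
    by-views : ρView k f p i₁ → ρView k f p i₂ → val (ρ k f) p i₁ ≤ val (ρ k f) p i₂
    by-views (fixed _ e₁) (fixed _ e₂) = subst₂ _≤_ (sym e₁) (sym e₂) f₁≤f₂
    by-views (moved act _ next≡ free₁ e₁) (fixed fixed₂ e₂) = subst₂ _≤_ (sym e₁) (sym e₂)
      (ℕP.≤-trans (proj₂ (newLabel-InPair i₁ next≡)) (ℕP.≤∧≢⇒< k≤f₂ (f₂≢k free₁ ∘ sym)))
      where
      k≤f₂ : k ≤ val f p i₂
      k≤f₂ = ℕP.≤-trans (proj₁ (LocallyFree⇒InPair free₁)) f₁≤f₂
      f₂≢k : LocallyFree k f p i₁ → val f p i₂ ≢ k
      f₂≢k (inj₁ raisable₁) f₂≡k = fixed₂ (act , LocallyFree⇒Free f∈L act next≡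
                                     (inj₁ (LocallyRaisable-later raisable₁ i₁≤i₂ f₂≡k)))
      f₂≢k (inj₂ (f₁≡suc , _)) f₂≡k = ℕP.<-irrefl refl (subst₂ _≤_ f₁≡suc f₂≡k f₁≤f₂)
    by-views (fixed fixed₁ e₁) (moved act _ next≡ free₂ e₂) = subst₂ _≤_ (sym e₁) (sym e₂)
      (ℕP.≤-trans (ℕP.≤-pred (ℕP.≤∧≢⇒< f₁≤suc (f₁≢suc free₂)))
                  (proj₁ (newLabel-InPair i₂ next≡)))
      where
      f₁≤suc : val f p i₁ ≤ suc k
      f₁≤suc = ℕP.≤-trans f₁≤f₂ (proj₂ (LocallyFree⇒InPair free₂))
      f₁≢suc : LocallyFree k f p i₂ → val f p i₁ ≢ suc k
      f₁≢suc (inj₂ lowerable₂) f₁≡suc = fixed₁ (act , LocallyFree⇒Free f∈L act next≡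
                                          (inj₂ (LocallyLowerable-earlier lowerable₂ i₁≤i₂ f₁≡suc)))
      f₁≢suc (inj₁ (f₂≡k , _)) f₁≡suc = ℕP.<-irrefl refl (subst₂ _≤_ f₁≡suc f₂≡k f₁≤f₂)
    by-views (moved _ _ next≡ _ e₁) (moved _ _ _ _ e₂) =
      subst₂ _≤_ (sym e₁) (sym e₂) (newLabel-mono next≡ i₁≤i₂)

  ρ-range : ∀ {k f} → InL Rq f → RangeCond Rq (ρ k f)
  ρ-range {k} {f} f∈L@(_ , _ , rangef) p j = by-view (ρ-view f∈L p j)
    where
    by-cases : Active p k → Dec (freeBefore k f p j < countB k f p) → Rq p (newLabel k f p j)
    by-cases act (yes lt) = subst (Rq p) (sym (newLabel-below lt)) (proj₁ act)
    by-cases act (no ¬lt) =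
      subst (Rq p) (sym (newLabel-above ¬lt)) (LeastAbove.member (nextR-leastAbove act))
    by-view : ρView k f p j → Rq p (val (ρ k f) p j)
    by-view (fixed _ e)         = subst (Rq p) (sym e) (rangef p j)
    by-view (moved act _ _ _ e) =
      subst (Rq p) (sym e) (by-cases act (freeBefore k f p j ℕ.<? countB k f p))

  ρ-InL : ∀ k {f} → InL Rq f → InL Rq (ρ k f)
  ρ-InL k f∈L = ρ-strict f∈L , ρ-weak f∈L , ρ-range f∈L

  ρ-fixes-upper : ∀ {k f p j} → InL Rq f → k ≤ val f p j → ∀ {p′} → p ≺ p′ → ∀ {j′} →
                  u p + toℕ j ≡ u p′ + toℕ j′ → val (ρ k f) p′ j′ ≡ val f p′ j′
  ρ-fixes-upper {k} {f} {p} {j} f∈L k≤f {p′} p≺p′ {j′} same-i = by-view (ρ-view f∈L p′ j′)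
    where
    by-view : ρView k f p′ j′ → val (ρ k f) p′ j′ ≡ val f p′ j′
    by-view (fixed _ e)            = e
    by-view (moved _ _ _ free′ _) = ⊥-elim (ℕP.<-irrefl refl
      (ℕP.<-≤-trans (LocallyFree⇒lower f∈L free′ p p≺p′ j same-i) k≤f))

  ρ-fixes-lower : ∀ {k f p j} → InL Rq f → val f p j ≤ suc k → ∀ {p′} → p′ ≺ p → ∀ {j′} →
                  u p′ + toℕ j′ ≡ u p + toℕ j → val (ρ k f) p′ j′ ≡ val f p′ j′
  ρ-fixes-lower {k} {f} {p} {j} f∈L f≤suc {p′} p′≺p {j′} same-i = by-view (ρ-view f∈L p′ j′)
    where
    by-view : ρView k f p′ j′ → val (ρ k f) p′ j′ ≡ val f p′ j′
    by-view (fixed _ e)            = e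
    by-view (moved _ _ _ free′ _) = ⊥-elim (ℕP.<-irrefl refl
      (ℕP.<-≤-trans (LocallyFree⇒upper f∈L free′ p p′≺p j same-i) f≤suc))

  upper-ρ⁺ : ∀ {k f p j x} → InL Rq f → k ≤ val f p j →
             UpperNeighboursAbove f p j x → UpperNeighboursAbove (ρ k f) p j x
  upper-ρ⁺ f∈L k≤f upper p′ p≺p′ j′ same-i =
    subst (_ <_) (sym (ρ-fixes-upper f∈L k≤f p≺p′ same-i)) (upper p′ p≺p′ j′ same-i)

  upper-ρ⁻ : ∀ {k f p j x} → InL Rq f → k ≤ val f p j →
             UpperNeighboursAbove (ρ k f) p j x → UpperNeighboursAbove f p j x
  upper-ρ⁻ f∈L k≤f upper p′ p≺p′ j′ same-i =
    subst (_ <_) (ρ-fixes-upper f∈L k≤f p≺p′ same-i) (upper p′ p≺p′ j′ same-i)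

  lower-ρ⁺ : ∀ {k f p j x} → InL Rq f → val f p j ≤ suc k →
             LowerNeighboursBelow f p j x → LowerNeighboursBelow (ρ k f) p j x
  lower-ρ⁺ f∈L f≤suc lower p′ p′≺p j′ same-i =
    subst (_< _) (sym (ρ-fixes-lower f∈L f≤suc p′≺p same-i)) (lower p′ p′≺p j′ same-i)

  lower-ρ⁻ : ∀ {k f p j x} → InL Rq f → val f p j ≤ suc k →
             LowerNeighboursBelow (ρ k f) p j x → LowerNeighboursBelow f p j x
  lower-ρ⁻ f∈L f≤suc lower p′ p′≺p j′ same-i =
    subst (_< _) (ρ-fixes-lower f∈L f≤suc p′≺p same-i) (lower p′ p′≺p j′ same-i)

  InPair-ρ⁻ : ∀ {k f} → InL Rq f → ∀ p j → InPair k (val (ρ k f) p j) → InPair k (val f p j)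
  InPair-ρ⁻ {k} {f} f∈L p j = by-view (ρ-view f∈L p j)
    where
    by-view : ρView k f p j → InPair k (val (ρ k f) p j) → InPair k (val f p j)
    by-view (fixed _ e)           = subst (InPair k) e
    by-view (moved _ _ _ free _) _ = LocallyFree⇒InPair free

  Free-ρ⁺ : ∀ {k f p j} → InL Rq f → Active p k → Free k f p j → Free k (ρ k f) p j
  Free-ρ⁺ {k} {f} {p} {j} f∈L@(strictf , weakf , _) act free =
    LocallyFree⇒Free (ρ-InL k f∈L) act next≡ (by-value (val (ρ k f) p j ℕ.≟ k))
    where
    next≡ : nextR p k ≡ suc k
    next≡ = free⇒nextR≡suc f∈L act free
    loc : LocallyFree k f p j
    loc = Free⇒LocallyFree next≡ free
    pair : InPair k (val (ρ k f) p j)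
    pair = subst (InPair k) (sym (ρ-moved act free)) (newLabel-InPair j next≡)
    upper : ∀ j′ → j F.≤ j′ → InPair k (val f p j′) → Dec (val f p j′ ≡ k) → LocallyFree k f p j →
            UpperNeighboursAbove f p j′ (suc k)
    upper j′ _ pair′ (no f′≢k) _ =
      subst (UpperNeighboursAbove f p j′) (InPair-≢⇒≡suc pair′ f′≢k) (strict⇒upper strictf p j′)
    upper j′ j≤j′ _ (yes f′≡k) (inj₁ (_ , upperf)) = upperf j′ j≤j′ f′≡k
    upper j′ j≤j′ _ (yes f′≡k) (inj₂ (f≡suc , _)) =
      ⊥-elim (ℕP.<-irrefl refl (subst₂ _≤_ f≡suc f′≡k (weakf p j j′ j≤j′)))
    lower : ∀ j′ → j′ F.≤ j → InPair k (val f p j′) → Dec (val f p j′ ≡ suc k) → LocallyFree k f p j →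
            LowerNeighboursBelow f p j′ k
    lower j′ _ pair′ (no f′≢suc) _ =
      subst (LowerNeighboursBelow f p j′) (InPair-≢suc⇒≡ pair′ f′≢suc) (strict⇒lower strictf p j′)
    lower j′ j′≤j _ (yes f′≡suc) (inj₂ (_ , lowerf)) = lowerf j′ j′≤j f′≡suc
    lower j′ j′≤j _ (yes f′≡suc) (inj₁ (f≡k , _)) =
      ⊥-elim (ℕP.<-irrefl refl (subst₂ _≤_ f′≡suc f≡k (weakf p j′ j j′≤j)))
    by-value : Dec (val (ρ k f) p j ≡ k) → LocallyFree k (ρ k f) p j
    by-value (yes g≡k) = inj₁ (g≡k , λ j′ j≤j′ g′≡k →
      let pair′ = InPair-ρ⁻ f∈L p j′ (≡⇒InPair g′≡k) in
      upper-ρ⁺ f∈L (proj₁ pair′) (upper j′ j≤j′ pair′ (val f p j′ ℕ.≟ k) loc))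
    by-value (no g≢k) = inj₂ (InPair-≢⇒≡suc pair g≢k , λ j′ j′≤j g′≡suc →
      let pair′ = InPair-ρ⁻ f∈L p j′ (≡suc⇒InPair g′≡suc) in
      lower-ρ⁺ f∈L (proj₂ pair′) (lower j′ j′≤j pair′ (val f p j′ ℕ.≟ suc k) loc))

  Free-ρ⁻ : ∀ {k f p j} → InL Rq f → Active p k → Free k (ρ k f) p j → Free k f p j
  Free-ρ⁻ {k} {f} {p} {j} f∈L act free-ρ = by-freeness (Free? k f p j)
    where
    next≡ : nextR p k ≡ suc k
    next≡ = free⇒nextR≡suc (ρ-InL k f∈L) act free-ρ
    upper : ∀ j′ → val f p j′ ≡ k → ρView k f p j′ →
            (val (ρ k f) p j′ ≡ k → UpperNeighboursAbove (ρ k f) p j′ (suc k)) →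
            UpperNeighboursAbove f p j′ (suc k)
    upper j′ f′≡k (fixed _ e′) upper-ρ =
      upper-ρ⁻ f∈L (ℕP.≤-reflexive (sym f′≡k)) (upper-ρ (trans e′ f′≡k))
    upper j′ _    (moved _ _ _ free′ _) _ = LocallyFree⇒upper f∈L free′
    lower : ∀ j′ → val f p j′ ≡ suc k → ρView k f p j′ →
            (val (ρ k f) p j′ ≡ suc k → LowerNeighboursBelow (ρ k f) p j′ k) →
            LowerNeighboursBelow f p j′ k
    lower j′ f′≡suc (fixed _ e′) lower-ρ =
      lower-ρ⁻ f∈L (ℕP.≤-reflexive f′≡suc) (lower-ρ (trans e′ f′≡suc))
    lower j′ _      (moved _ _ _ free′ _) _ = LocallyFree⇒lower f∈L free′
    unmoved : val (ρ k f) p j ≡ val f p j → LocallyFree k (ρ k f) p j → LocallyFree k f p j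
    unmoved e (inj₁ (g≡k , upper-ρ)) = inj₁ (trans (sym e) g≡k , λ j′ j≤j′ f′≡k →
      upper j′ f′≡k (ρ-view f∈L p j′) (upper-ρ j′ j≤j′))
    unmoved e (inj₂ (g≡suc , lower-ρ)) = inj₂ (trans (sym e) g≡suc , λ j′ j′≤j f′≡suc →
      lower j′ f′≡suc (ρ-view f∈L p j′) (lower-ρ j′ j′≤j))
    by-freeness : Dec (Free k f p j) → Free k f p j
    by-freeness (yes free) = free
    by-freeness (no ¬free) = LocallyFree⇒Free f∈L act next≡
      (unmoved (ρ-fixed (¬free ∘ proj₂)) (Free⇒LocallyFree next≡ free-ρ))

  -- ρ_k fixes the set of free positions of F_p, on which the labels of f are sorted: k before k+1.
  -- So ρ_k(ρ_k f) puts k exactly at the first |free| − b free positions, i.e. where f has k.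
  module _ {k f} (f∈L : InL Rq f) {p} (act : Active p k) where

    private
      free⇒nextR≡ : ∀ {j} → Free k f p j → nextR p k ≡ suc k
      free⇒nextR≡ = free⇒nextR≡suc f∈L act

      free-ρ⁺ : ∀ {j} → Free k f p j → Free k (ρ k f) p j
      free-ρ⁺ = Free-ρ⁺ f∈L act

      free-ρ⁻ : ∀ {j} → Free k (ρ k f) p j → Free k f p j
      free-ρ⁻ = Free-ρ⁻ f∈L act

      AtNext-upward : ∀ {i i′} → Free k f p i → Free k f p i′ → i F.≤ i′ →
                      val f p i ≡ nextR p k → val f p i′ ≡ nextR p k
      AtNext-upward {i} {i′} free free′ i≤i′ fi≡next = trans (ℕP.≤-antisym
        (proj₂ (LocallyFree⇒InPair (Free⇒LocallyFree (free⇒nextR≡ free′) free′)))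
        (subst (_≤ val f p i′) (trans fi≡next (free⇒nextR≡ free)) (proj₁ (proj₂ f∈L) p i i′ i≤i′)))
        (sym (free⇒nextR≡ free))

      freeBefore-ρ : ∀ j → freeBefore k (ρ k f) p j ≡ rank (Free? k f p) j
      freeBefore-ρ j = trans (freeBefore-cong (λ _ → free-ρ⁻) (λ _ → free-ρ⁺) j) (freeBefore≡rank k f p j)

      rank<countB⇒newLabel≡k : ∀ {j} → rank (Free? k f p) j < countB k f p → newLabel k f p j ≡ k
      rank<countB⇒newLabel≡k {j} lt = newLabel-below (subst (_< countB k f p) (sym (freeBefore≡rank k f p j)) lt)

      countB-ρ : countB k (ρ k f) p ≡ count (Free? k f p) ∸ count (Free? k f p ∩? AtNext? k f p)
      countB-ρ = begin
        countB k (ρ k f) p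
          ≡⟨ countB≡count k (ρ k f) p ⟩
        count (Free? k (ρ k f) p ∩? AtNext? k (ρ k f) p)
          ≡⟨ count-cong (Free? k (ρ k f) p ∩? AtNext? k (ρ k f) p) (Free? k f p ∩? ∁? below?) to from ⟩
        count (Free? k f p ∩? ∁? below?)
          ≡⟨ count-rank≥ (Free? k f p) b≤count ⟩
        count (Free? k f p) ∸ countB k f p
          ≡⟨ cong (λ c → count (Free? k f p) ∸ c) (countB≡count k f p) ⟩
        count (Free? k f p) ∸ count (Free? k f p ∩? AtNext? k f p) ∎
        where
        open ≡-Reasoning
        below? : Decidable (λ i → rank (Free? k f p) i < countB k f p)
        below? i = rank (Free? k f p) i ℕ.<? countB k f p
        b≤count : countB k f p ≤ count (Free? k f p)
        b≤count = subst (_≤ count (Free? k f p)) (sym (countB≡count k f p))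
                    (count-mono (Free? k f p ∩? AtNext? k f p) (Free? k f p) proj₁)
        to : Free k (ρ k f) p ∩ (λ j → val (ρ k f) p j ≡ nextR p k) ⊆
             Free k f p ∩ ∁ (λ i → rank (Free? k f p) i < countB k f p)
        to {j} (free-ρ , ρ≡next) = free , λ lt →
          ℕP.<-irrefl (trans (sym (rank<countB⇒newLabel≡k lt)) (trans (sym (ρ-moved act free)) ρ≡next))
                      (LeastAbove.above (nextR-leastAbove act))
          where
          free : Free k f p j
          free = free-ρ⁻ free-ρ
        from : Free k f p ∩ ∁ (λ i → rank (Free? k f p) i < countB k f p) ⊆
               Free k (ρ k f) p ∩ (λ j → val (ρ k f) p j ≡ nextR p k)
        from {j} (free , ¬lt) = free-ρ⁺ free , trans (ρ-moved act free)
          (newLabel-above (¬lt ∘ subst (_< countB k f p) (freeBefore≡rank k f p j)))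

    ρ-ρ-free : ∀ {j} → Free k (ρ k f) p j → val (ρ k (ρ k f)) p j ≡ val f p j
    ρ-ρ-free {j} free-ρ = trans (ρ-moved act free-ρ) (by-value (AtNext? k f p j))
      where
      free : Free k f p j
      free = free-ρ⁻ free-ρ
      next≡ : nextR p k ≡ suc k
      next≡ = free⇒nextR≡ free
      by-value : Dec (val f p j ≡ nextR p k) → newLabel k (ρ k f) p j ≡ val f p j
      by-value (yes f≡next) = trans (newLabel-above λ lt → ℕP.<-irrefl refl (ℕP.<-≤-trans
          (subst₂ _<_ (freeBefore-ρ j) countB-ρ lt)
          (∈upset⇒rank≥ (Free? k f p) (AtNext? k f p) AtNext-upward free f≡next)))
        (sym f≡next)
      by-value (no f≢next) = trans (newLabel-below (subst₂ _<_ (sym (freeBefore-ρ j)) (sym countB-ρ)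
          (∉upset⇒rank< (Free? k f p) (AtNext? k f p) AtNext-upward free f≢next)))
        (sym (InPair-≢suc⇒≡ (LocallyFree⇒InPair (Free⇒LocallyFree next≡ free))
                            (f≢next ∘ flip trans (sym next≡))))

  ρ-involutive : ∀ k {f} → InL Rq f → ρ k (ρ k f) ≡ f
  ρ-involutive k {f} f∈L = Lab-ext λ p j → by-views (ρ-view (ρ-InL k f∈L) p j) (ρ-view f∈L p j)
    where
    by-views : ∀ {p j} → ρView k (ρ k f) p j → ρView k f p j → val (ρ k (ρ k f)) p j ≡ val f p j
    by-views (moved act free-ρ _ _ _) _                  = ρ-ρ-free f∈L act free-ρ
    by-views (fixed _ e) (fixed _ e′)                     = trans e e′
    by-views (fixed unmoved _) (moved act free _ _ _)     = ⊥-elim (unmoved (act , Free-ρ⁺ f∈L act free))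

  -- Distant moves commute

  ρ-AgreeOutside : ∀ k′ {f} → InL Rq f → ∀ p j → AgreeOutside k′ (val f p j) (val (ρ k′ f) p j)
  ρ-AgreeOutside k′ {f} f∈L p j = by-view (ρ-view f∈L p j)
    where
    by-view : ρView k′ f p j → AgreeOutside k′ (val f p j) (val (ρ k′ f) p j)
    by-view (fixed _ e)                  = inj₁ (sym e)
    by-view (moved _ _ next≡ free e)     =
      inj₂ (LocallyFree⇒InPair free , subst (InPair k′) (sym e) (newLabel-InPair j next≡))

  LocallyFree-AgreeOutside : ∀ {k k′ f g p j} → Far k k′ → (∀ p j → AgreeOutside k′ (val f p j) (val g p j)) →
                        LocallyFree k f p j → LocallyFree k g p j
  LocallyFree-AgreeOutside {k} {k′} {f} {g} {p} {j} far f~g = transport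
    where
    ≡k : ∀ {j} → val f p j ≡ k → val g p j ≡ k
    ≡k {j} f≡k = trans (AgreeOutside-InPair far (≡⇒InPair f≡k) (AgreeOutside-sym (f~g p j))) f≡k
    ≡k⁻ : ∀ {j} → val g p j ≡ k → val f p j ≡ k
    ≡k⁻ {j} g≡k = trans (AgreeOutside-InPair far (≡⇒InPair g≡k) (f~g p j)) g≡k
    ≡suc : ∀ {j} → val f p j ≡ suc k → val g p j ≡ suc k
    ≡suc {j} f≡suc = trans (AgreeOutside-InPair far (≡suc⇒InPair f≡suc) (AgreeOutside-sym (f~g p j))) f≡suc
    ≡suc⁻ : ∀ {j} → val g p j ≡ suc k → val f p j ≡ suc k
    ≡suc⁻ {j} g≡suc = trans (AgreeOutside-InPair far (≡suc⇒InPair g≡suc) (f~g p j)) g≡suc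
    transport : LocallyFree k f p j → LocallyFree k g p j
    transport (inj₁ (f≡k , upper)) = inj₁ (≡k f≡k , λ j′ j≤j′ g′≡k p′ p≺p′ j″ same-i →
      AgreeOutside-above far (f~g p′ j″) (upper j′ j≤j′ (≡k⁻ g′≡k) p′ p≺p′ j″ same-i))
    transport (inj₂ (f≡suc , lower)) = inj₂ (≡suc f≡suc , λ j′ j′≤j g′≡suc p′ p′≺p j″ same-i →
      AgreeOutside-below far (f~g p′ j″) (lower j′ j′≤j (≡suc⁻ g′≡suc) p′ p′≺p j″ same-i))

  Free-AgreeOutside : ∀ {k k′ f g p j} → Far k k′ → InL Rq f → InL Rq g →
                      (∀ p j → AgreeOutside k′ (val f p j) (val g p j)) →
                      Active p k → Free k f p j → Free k g p j
  Free-AgreeOutside {k} {p = p} far f∈L g∈L f~g act free = LocallyFree⇒Free g∈L act next≡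
    (LocallyFree-AgreeOutside far f~g (Free⇒LocallyFree next≡ free))
    where
    next≡ : nextR p k ≡ suc k
    next≡ = free⇒nextR≡suc f∈L act free

  countB-cong : ∀ {k f g p} → (∀ j → Free k f p j → Free k g p j) → (∀ j → Free k g p j → Free k f p j) →
                (∀ j → Free k f p j → val f p j ≡ val g p j) → countB k f p ≡ countB k g p
  countB-cong {k} {f} {g} {p} f⊆g g⊆f same = begin
    countB k f p                              ≡⟨ countB≡count k f p ⟩
    count (Free? k f p ∩? AtNext? k f p)
      ≡⟨ count-cong (Free? k f p ∩? AtNext? k f p) (Free? k g p ∩? AtNext? k g p)
           (λ (free , f≡next) → f⊆g _ free , trans (sym (same _ free)) f≡next)
           (λ (free , g≡next) → g⊆f _ free , trans (same _ (g⊆f _ free)) g≡next) ⟩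
    count (Free? k g p ∩? AtNext? k g p)      ≡⟨ sym (countB≡count k g p) ⟩
    countB k g p                              ∎
    where open ≡-Reasoning

  newLabel-cong : ∀ {k f g p} → (∀ j → Free k f p j → Free k g p j) → (∀ j → Free k g p j → Free k f p j) →
                  (∀ j → Free k f p j → val f p j ≡ val g p j) → ∀ j → newLabel k f p j ≡ newLabel k g p j
  newLabel-cong {k} {f} {g} {p} f⊆g g⊆f same j =
    cong₂ (λ before b → if does (before ℕ.<? b) then k else nextR p k)
      (freeBefore-cong f⊆g g⊆f j) (countB-cong f⊆g g⊆f same)

  module _ {f} (f∈L : InL Rq f) where

    private
      free-far⁺ : ∀ {a b p j} → Far a b → Active p a → Free a f p j → Free a (ρ b f) p j
      free-far⁺ {a} {b} far = Free-AgreeOutside far f∈L (ρ-InL b f∈L) (ρ-AgreeOutside b f∈L)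

      free-far⁻ : ∀ {a b p j} → Far a b → Active p a → Free a (ρ b f) p j → Free a f p j
      free-far⁻ {a} {b} far =
        Free-AgreeOutside far (ρ-InL b f∈L) f∈L (λ p j → AgreeOutside-sym (ρ-AgreeOutside b f∈L p j))

      free⇒InPair : ∀ {a p j} → Active p a → Free a f p j → InPair a (val f p j)
      free⇒InPair act free = LocallyFree⇒InPair (Free⇒LocallyFree (free⇒nextR≡suc f∈L act free) free)

      newLabel-far : ∀ {a b p} → Far a b → Active p a → ∀ j → newLabel a (ρ b f) p j ≡ newLabel a f p j
      newLabel-far {a} {b} {p} far act = newLabel-cong (λ _ → free-far⁻ far act) (λ _ → free-far⁺ far act)
        λ j free → AgreeOutside-InPair far (free⇒InPair act (free-far⁻ far act free))
                                           (AgreeOutside-sym (ρ-AgreeOutside b f∈L p j))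

    ρ-comm : ∀ i k → Far i k → ρ i (ρ k f) ≡ ρ k (ρ i f)
    ρ-comm i k far = Lab-ext λ p j → by-views (ρ-view (ρ-InL k f∈L) p j) (ρ-view (ρ-InL i f∈L) p j)
      where
      open ≡-Reasoning
      by-views : ∀ {p j} → ρView i (ρ k f) p j → ρView k (ρ i f) p j →
                 val (ρ i (ρ k f)) p j ≡ val (ρ k (ρ i f)) p j
      by-views (moved acti freei _ _ _) (moved actk freek _ _ _) = ⊥-elim (Far⇒¬InPair far
        (free⇒InPair acti (free-far⁻ far acti freei)) (free⇒InPair actk (free-far⁻ (Far-sym far) actk freek)))
      by-views {p} {j} (moved acti freei _ _ ρiρk≡) (fixed _ ρkρi≡) = begin
        val (ρ i (ρ k f)) p j  ≡⟨ ρiρk≡ ⟩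
        newLabel i (ρ k f) p j ≡⟨ newLabel-far far acti j ⟩
        newLabel i f p j       ≡⟨ ρ-moved acti (free-far⁻ far acti freei) ⟨
        val (ρ i f) p j        ≡⟨ ρkρi≡ ⟨
        val (ρ k (ρ i f)) p j  ∎
      by-views {p} {j} (fixed _ ρiρk≡) (moved actk freek _ _ ρkρi≡) = begin
        val (ρ i (ρ k f)) p j  ≡⟨ ρiρk≡ ⟩
        val (ρ k f) p j        ≡⟨ ρ-moved actk (free-far⁻ (Far-sym far) actk freek) ⟩
        newLabel k f p j       ≡⟨ newLabel-far (Far-sym far) actk j ⟨
        newLabel k (ρ i f) p j ≡⟨ ρkρi≡ ⟨
        val (ρ k (ρ i f)) p j  ∎
      by-views {p} {j} (fixed unmovedi ρiρk≡) (fixed unmovedk ρkρi≡) = begin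
        val (ρ i (ρ k f)) p j  ≡⟨ ρiρk≡ ⟩
        val (ρ k f) p j        ≡⟨ ρ-fixed (λ (actk , freek) → unmovedk (actk , free-far⁺ (Far-sym far) actk freek)) ⟩
        val f p j              ≡⟨ ρ-fixed (λ (acti , freei) → unmovedi (acti , free-far⁺ far acti freei)) ⟨
        val (ρ i f) p j        ≡⟨ ρkρi≡ ⟨
        val (ρ k (ρ i f)) p j  ∎

  -- Evacuation and promotion

  module Words = InvolutionWords (InL Rq) ρ ρ-InL ρ-involutive
                                 (λ i k i+1<k f∈L → ρ-comm f∈L i k (inj₁ i+1<k))

  chain≡ : ∀ m f → chain m f ≡ Words.chain m f
  chain≡ zero    f = refl
  chain≡ (suc m) f = cong (ρ (suc m)) (chain≡ m f)

  evacAux≡ : ∀ m f → evacAux m f ≡ Words.evac m f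
  evacAux≡ zero    f = refl
  evacAux≡ (suc m) f = trans (evacAux≡ m (chain (suc m) f)) (cong (Words.evac m) (chain≡ (suc m) f))

  Evac-involutive : ∀ {f} → InL Rq f → Evac (Evac f) ≡ f
  Evac-involutive {f} f∈L = begin
    evacAux m (evacAux m f)         ≡⟨ evacAux≡ m (evacAux m f) ⟩
    Words.evac m (evacAux m f)      ≡⟨ cong (Words.evac m) (evacAux≡ m f) ⟩
    Words.evac m (Words.evac m f)   ≡⟨ Words.evac-involutive m f∈L ⟩
    f                               ∎
    where
    open ≡-Reasoning
    m : ℕ
    m = q ∸ 1

  Pro-Evac-Pro : ∀ {f} → InL Rq f → Pro (Evac (Pro f)) ≡ Evac f
  Pro-Evac-Pro {f} f∈L = begin
    chain m (evacAux m (chain m f))                     ≡⟨ chain≡ m _ ⟩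
    Words.chain m (evacAux m (chain m f))               ≡⟨ cong (Words.chain m) (evacAux≡ m _) ⟩
    Words.chain m (Words.evac m (chain m f))            ≡⟨ cong (Words.chain m ∘ Words.evac m) (chain≡ m f) ⟩
    Words.chain m (Words.evac m (Words.chain m f))      ≡⟨ Words.chain-evac-chain m f∈L ⟩
    Words.evac m f                                      ≡⟨ sym (evacAux≡ m f) ⟩
    evacAux m f                                         ∎
    where
    open ≡-Reasoning
    m : ℕ
    m = q ∸ 1

-- Only f ∈ L(u,v,R^q) is used: the identities hold without the hypotheses on ℓ, q, u, v and R^q.
proposition3p16 :
    (n : ℕ) (_≼_ : Fin n → Fin n → Set) (po : IsDecPartialOrder _≡_ _≼_)
    (ℓ q : ℕ) → 1 ≤ ℓ → 1 ≤ q →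
    (u v : Fin n → ℕ) →
    (∀ p → u p + v p ≤ ℓ) →
    (∀ p₁ p₂ → p₁ ≼ p₂ → v p₁ ≤ v p₂ × u p₂ ≤ u p₁) →
    let open Setup po ℓ q u v in
    (∀ p → ∃ λ k → Rq p k) →
    ∀ (f : Lab) → InL Rq f →
    Evac (Evac f) ≡ f × Pro (Evac (Pro f)) ≡ Evac f
proposition3p16 n _≼_ po ℓ q _ _ u v _ _ _ f f∈L = Evac-involutive f∈L , Pro-Evac-Pro f∈L
  where open BenderKnuth po ℓ q u v
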